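{- Let $n\ge 1$ and let $f:E(K_n)\to\{ -1,1\}$ be a colouring with $\min\{e(-1),e(1)\}>\binom{\lfloor\frac{n-1}{2}\rfloor}{2}$. Then $K_n$ contains a spanning tree $T$ with $|f(T)|\le 1$ (zero-sum or almost zero-sum). Moreover, the result is sharp: for every $n\ge 3$ there is a colouring $f:E(K_n)\to\{ -1,1\}$ with $\min\{e(-1),e(1)\}=\binom{\lfloor\frac{n-1}{2}\rfloor}{2}$ such that no spanning tree $T$ of $K_n$ has $|f(T)|\le 1$.
   Context: For $f:E(K_n)\to\{ -1,1\}$ and a subgraph $H$, $f(H)=\sum_{e\in E(H)}f(e)$; $e(-1)$ and $e(1)$ denote the numbers of edges coloured $-1$ and $1$ respectively. -}

module Defs where

open import Data.Nat using (ℕ; zero; suc; _≤_; _<_)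
open import Data.Bool using (Bool; true; false)
open import Data.Bool.Properties using () renaming (_≟_ to _≟ᵇ_)
open import Data.Fin using (Fin) renaming (_<_ to _<ᶠ_; _<?_ to _<?ᶠ_)
open import Data.Fin.Properties using ()
open import Data.List using (List; []; _∷_; length; filter; map; cartesianProduct; allFin)
open import Data.Product using (_×_; _,_; proj₁; proj₂; Σ; ∃)
open import Data.Sum using (_⊎_)
open import Data.Vec using (Vec; lookup; head; last)
open import Data.Integer using (ℤ; +_; -[1+_]) renaming (_+_ to _+ℤ_)
open import Data.List using (foldr)
open import Relation.Binary.PropositionalEquality using (_≡_)
open import Relation.Nullary.Decidable using (_×-dec_)
open import Function using (Injective)
open import Data.Empty using (⊥)

Edge : ℕ → Set
Edge n = Fin n × Fin n

edges : (n : ℕ) → List (Edge n)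
edges n = filter (λ p → proj₁ p <?ᶠ proj₂ p) (cartesianProduct (allFin n) (allFin n))

-- A 2-colouring of E(K_n) with colours {-1,1}: the colour of edge {i,j}, i<j,
-- is given by  c i j  (true ↦ 1, false ↦ -1).  Values c i j with i ≥ j are irrelevant.
Colouring : ℕ → Set
Colouring n = Fin n → Fin n → Bool

sgn : Bool → ℤ
sgn true  = + 1
sgn false = -[1+ 0 ]

eCol : ∀ {n} → Colouring n → Bool → ℕ
eCol {n} c b = length (filter (λ p → c (proj₁ p) (proj₂ p) ≟ᵇ b) (edges n))

-- A spanning subgraph of K_n, given by its edge set: edge {i,j} (i<j) is present iff t i j ≡ true.
EdgeSet : ℕ → Set
EdgeSet n = Fin n → Fin n → Bool

Adj : ∀ {n} → EdgeSet n → Fin n → Fin n → Set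
Adj t u v = (u <ᶠ v × t u v ≡ true) ⊎ (v <ᶠ u × t v u ≡ true)

data Reach {n} (t : EdgeSet n) : Fin n → Fin n → Set where
  here : ∀ {u} → Reach t u u
  step : ∀ {u v w} → Adj t u v → Reach t v w → Reach t u w

Connected : ∀ {n} → EdgeSet n → Set
Connected t = ∀ u v → Reach t u v

record Cycle {n} (t : EdgeSet n) : Set where
  field
    k        : ℕ
    verts    : Fin (suc (suc (suc k))) → Fin n
    distinct : Injective _≡_ _≡_ verts
    consec   : ∀ (i : Fin (suc (suc k))) →
                 Adj t (verts (Data.Fin.inject₁ i)) (verts (Data.Fin.suc i))
    closing  : Adj t (verts (Data.Fin.fromℕ (suc (suc k)))) (verts Data.Fin.zero)

Acyclic : ∀ {n} → EdgeSet n → Set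
Acyclic t = Cycle t → ⊥

SpanningTree : ∀ {n} → EdgeSet n → Set
SpanningTree t = Connected t × Acyclic t

weight : ∀ {n} → Colouring n → EdgeSet n → ℤ
weight {n} c t =
  foldr _+ℤ_ (+ 0) (map (λ p → sgn (c (proj₁ p) (proj₂ p)))
                        (filter (λ p → t (proj₁ p) (proj₂ p) ≟ᵇ true) (edges n)))

-- Grow a tree from vertex 0, attaching a new vertex by an edge of colour b whenever an edge of colour b
-- leaves the tree, and otherwise by an edge of the other colour from the root (a jump).  No edge of colour b
-- crosses a jump, so after k jumps all e(b) edges of colour b lie inside k + 1 blocks of vertices and
-- e(b) ≤ C(n − k, 2); the hypothesis then forces 2k ≤ n.  This yields one spanning tree with at most n/2
-- positive edges and one with at most n/2 negative edges.  Changing the parent of one vertex at a time moves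
-- the number of positive edges by at most one, so some tree in between has |f(T)| ≤ 1.
-- For sharpness, colour −1 exactly the edges inside the first m = ⌊(n − 1)/2⌋ vertices.  Breadth-first search
-- shows that every spanning tree consists of the edges from each vertex to its parent, so it has n − 1 edges,
-- at most m − 1 of them negative, and f(T) ≥ n + 1 − 2m ≥ 2.

module Submission where

open import Defs
open import Data.Nat using (ℕ; _≤_; _<_; _⊓_; _/_)
open import Data.Nat.Combinatorics using (_C_)
open import Data.Nat.Base using (_∸_)
open import Data.Bool using (true; false)
open import Data.Integer using (∣_∣)
open import Data.Product using (_×_; Σ; _,_)
open import Relation.Binary.PropositionalEquality using (_≡_)

open import Data.Nat using (zero; suc; pred; _+_; _*_; z≤n; s≤s; s≤s⁻¹; _≤?_; _<?_)
import Data.Nat as ℕ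
open import Data.Nat.Properties
open import Data.Nat.DivMod using (m*n/n≡m; /-monoˡ-≤; m/n*n≤m; m≥n⇒m/n>0)
open import Data.Nat.Combinatorics using (nCk+nC[k+1]≡[n+1]C[k+1]; nC1≡n)
open import Data.Nat.Tactic.RingSolver using (solve-∀)
open import Data.Bool using (Bool; not; _∨_; if_then_else_)
open import Data.Bool.Properties using (∨-zeroʳ; ¬-not; T-≡) renaming (_≟_ to _≟ᶜ_)
open import Data.Fin using (Fin; toℕ; fromℕ; fromℕ<; inject₁)
  renaming (zero to fzero; suc to fsuc; _<_ to _<ᶠ_)
import Data.Fin.Properties as Fin
open import Data.List using (List; []; _∷_; _++_; length; filter; map; cartesianProduct; allFin; tabulate; foldr)
open import Data.List.Extrema.Nat using (argmax; f[xs]≤f[argmax])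
import Data.List.Relation.Unary.All as All
open import Data.List.Membership.Propositional.Properties using (∈-allFin)
open import Data.Product using (∃; proj₁; proj₂)
open import Data.Sum using (_⊎_; inj₁; inj₂)
open import Data.Empty using (⊥; ⊥-elim)
open import Data.Integer using (ℤ; 0ℤ; _⊖_) renaming (_+_ to _+ℤ_)
import Data.Integer.Properties as ℤ
open import Function using (_∘_)
open import Function.Bundles using (Equivalence)
open import Relation.Nullary using (Dec; yes; no; does; ¬_)
open import Relation.Nullary.Decidable using (dec-true; dec-false; _×-dec_; _⊎-dec_)
open import Relation.Unary using (Decidable)
open import Relation.Binary using (tri<; tri≈; tri>)
open import Relation.Binary.PropositionalEquality
open import Algebra.Properties.CommutativeMonoid.Sum +-0-commutativeMonoid
  using (sum-syntax; sum-cong-≗; ∑-distrib-+; ∑-comm; sum-replicate-zero)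

from-does : ∀ {A : Set} (a? : Dec A) → does a? ≡ true → A
from-does (yes a) _ = a

∨-true : ∀ a b → a ∨ b ≡ true → a ≡ true ⊎ b ≡ true
∨-true true  b _ = inj₁ refl
∨-true false b e = inj₂ e

_≡ᵇ_ : ∀ {n} → Fin n → Fin n → Bool
i ≡ᵇ j = does (i Fin.≟ j)

_<ᵇ_ : ∀ {n} → Fin n → Fin n → Bool
i <ᵇ j = does (i Fin.<? j)

≡ᵇ-refl : ∀ {n} (i : Fin n) → i ≡ᵇ i ≡ true
≡ᵇ-refl i = dec-true (i Fin.≟ i) refl

when : Bool → ℕ → ℕ
when true  n = n
when false _ = 0

when-comm : ∀ a b n → when a (when b n) ≡ when b (when a n)
when-comm true  true  n = refl
when-comm true  false n = refl
when-comm false true  n = refl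
when-comm false false n = refl

when-+ : ∀ a x y → when a (x + y) ≡ when a x + when a y
when-+ true  x y = refl
when-+ false x y = refl

∑-when : ∀ {n} a (f : Fin n → ℕ) → ∑[ i < n ] when a (f i) ≡ when a (∑[ i < n ] f i)
∑-when {n} true  f = refl
∑-when {n} false f = sum-replicate-zero n

∑-mono-≤ : ∀ {n} {f g : Fin n → ℕ} → (∀ i → f i ≤ g i) → ∑[ i < n ] f i ≤ ∑[ i < n ] g i
∑-mono-≤ {zero}  f≤g = z≤n
∑-mono-≤ {suc n} f≤g = +-mono-≤ (f≤g fzero) (∑-mono-≤ (f≤g ∘ fsuc))

∑-const-1 : ∀ n → ∑[ i < n ] 1 ≡ n
∑-const-1 zero    = refl
∑-const-1 (suc n) = cong suc (∑-const-1 n)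

∑-zero : ∀ {n} {f : Fin n → ℕ} → (∀ i → f i ≡ 0) → ∑[ i < n ] f i ≡ 0
∑-zero {n} f≡0 = trans (sum-cong-≗ f≡0) (sum-replicate-zero n)

∑-when-≡ᵇ : ∀ {n} (a : Fin n) (f : Fin n → ℕ) → ∑[ i < n ] when (a ≡ᵇ i) (f i) ≡ f a
∑-when-≡ᵇ {suc n} fzero    f = trans (cong (f fzero +_) (sum-replicate-zero n)) (+-identityʳ _)
∑-when-≡ᵇ {suc n} (fsuc a) f = ∑-when-≡ᵇ a (λ i → f (fsuc i))

𝟙[_≡_] : Bool → Bool → ℕ
𝟙[ x ≡ b ] = when (does (x ≟ᶜ b)) 1

sumᴱ : ∀ n → (Fin n → Fin n → ℕ) → ℕ
sumᴱ n X = ∑[ i < n ] ∑[ j < n ] when (i <ᵇ j) (X i j)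

sumᴱ-cong : ∀ {n} {X Y : Fin n → Fin n → ℕ} → (∀ i j → X i j ≡ Y i j) → sumᴱ n X ≡ sumᴱ n Y
sumᴱ-cong X≡Y = sum-cong-≗ λ i → sum-cong-≗ λ j → cong (when _) (X≡Y i j)

sumᴱ-+ : ∀ {n} (X Y : Fin n → Fin n → ℕ) → sumᴱ n (λ i j → X i j + Y i j) ≡ sumᴱ n X + sumᴱ n Y
sumᴱ-+ {n} X Y = begin
  sumᴱ n (λ i j → X i j + Y i j)
    ≡⟨ sum-cong-≗ (λ i → trans (sum-cong-≗ λ j → when-+ (i <ᵇ j) (X i j) (Y i j)) (∑-distrib-+ (row X i) (row Y i))) ⟩
  ∑[ i < n ] (∑[ j < n ] row X i j + ∑[ j < n ] row Y i j)
    ≡⟨ ∑-distrib-+ (λ i → ∑[ j < n ] row X i j) (λ i → ∑[ j < n ] row Y i j) ⟩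
  sumᴱ n X + sumᴱ n Y ∎
  where
  open ≡-Reasoning
  row : (Fin n → Fin n → ℕ) → Fin n → Fin n → ℕ
  row Z i j = when (i <ᵇ j) (Z i j)

sumᴱ-from : ∀ {n} (v : Fin n) (Y : Fin n → Fin n → ℕ) →
            sumᴱ n (λ i j → when (v ≡ᵇ i) (Y i j)) ≡ ∑[ j < n ] when (v <ᵇ j) (Y v j)
sumᴱ-from {n} v Y = trans (sum-cong-≗ λ i → trans (sum-cong-≗ λ j → when-comm (i <ᵇ j) (v ≡ᵇ i) (Y i j))
                                                 (∑-when (v ≡ᵇ i) (λ j → when (i <ᵇ j) (Y i j))))
                          (∑-when-≡ᵇ v (λ i → ∑[ j < n ] when (i <ᵇ j) (Y i j)))

sumᴱ-to : ∀ {n} (v : Fin n) (Y : Fin n → Fin n → ℕ) →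
          sumᴱ n (λ i j → when (v ≡ᵇ j) (Y i j)) ≡ ∑[ i < n ] when (i <ᵇ v) (Y i v)
sumᴱ-to {n} v Y = trans (∑-comm (λ i j → when (i <ᵇ j) (when (v ≡ᵇ j) (Y i j))))
                  (trans (sum-cong-≗ λ j → trans (sum-cong-≗ λ i → when-comm (i <ᵇ j) (v ≡ᵇ j) (Y i j))
                                                 (∑-when (v ≡ᵇ j) (λ i → when (i <ᵇ j) (Y i j))))
                         (∑-when-≡ᵇ v (λ j → ∑[ i < n ] when (i <ᵇ j) (Y i j))))

sumOver : ∀ {A : Set} → (A → ℕ) → List A → ℕ
sumOver w []       = 0
sumOver w (x ∷ xs) = w x + sumOver w xs

length≡sumOver-1 : ∀ {A : Set} (xs : List A) → length xs ≡ sumOver (λ _ → 1) xs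
length≡sumOver-1 []       = refl
length≡sumOver-1 (x ∷ xs) = cong suc (length≡sumOver-1 xs)

sumOver-filter : ∀ {A : Set} {P : A → Set} (P? : Decidable P) (w : A → ℕ) xs →
                 sumOver w (filter P? xs) ≡ sumOver (λ x → when (does (P? x)) (w x)) xs
sumOver-filter P? w []       = refl
sumOver-filter P? w (x ∷ xs) with does (P? x)
... | false = sumOver-filter P? w xs
... | true  = cong (w x +_) (sumOver-filter P? w xs)

sumOver-++ : ∀ {A : Set} (w : A → ℕ) xs ys → sumOver w (xs ++ ys) ≡ sumOver w xs + sumOver w ys
sumOver-++ w []       ys = refl
sumOver-++ w (x ∷ xs) ys = trans (cong (w x +_) (sumOver-++ w xs ys)) (sym (+-assoc (w x) _ _))

sumOver-map : ∀ {A B : Set} (w : B → ℕ) (f : A → B) xs → sumOver w (map f xs) ≡ sumOver (λ x → w (f x)) xs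
sumOver-map w f []       = refl
sumOver-map w f (x ∷ xs) = cong (w (f x) +_) (sumOver-map w f xs)

sumOver-cartesianProduct : ∀ {A B : Set} (w : A × B → ℕ) xs ys →
  sumOver w (cartesianProduct xs ys) ≡ sumOver (λ x → sumOver (λ y → w (x , y)) ys) xs
sumOver-cartesianProduct w []       ys = refl
sumOver-cartesianProduct w (x ∷ xs) ys = trans (sumOver-++ w (map (x ,_) ys) _)
  (cong₂ _+_ (sumOver-map w (x ,_) ys) (sumOver-cartesianProduct w xs ys))

sumOver-tabulate : ∀ {A : Set} {n} (w : A → ℕ) (f : Fin n → A) → sumOver w (tabulate f) ≡ ∑[ i < n ] w (f i)
sumOver-tabulate {n = zero}  w f = refl
sumOver-tabulate {n = suc n} w f = cong (w (f fzero) +_) (sumOver-tabulate w (λ i → f (fsuc i)))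

sumOver-edges : ∀ n (w : Edge n → ℕ) → sumOver w (edges n) ≡ sumᴱ n (λ i j → w (i , j))
sumOver-edges n w =
  trans (sumOver-filter (λ p → proj₁ p Fin.<? proj₂ p) w (cartesianProduct (allFin n) (allFin n)))
  (trans (sumOver-cartesianProduct _ (allFin n) (allFin n))
  (trans (sumOver-tabulate row (λ i → i))
         (sum-cong-≗ λ i → sumOver-tabulate (λ j → when (i <ᵇ j) (w (i , j))) (λ j → j))))
  where
  row : Fin n → ℕ
  row i = sumOver (λ j → when (i <ᵇ j) (w (i , j))) (allFin n)

count : ∀ {n} → Colouring n → EdgeSet n → Bool → ℕ
count {n} c t b = sumᴱ n (λ i j → when (t i j) 𝟙[ c i j ≡ b ])

eCol≡sumᴱ : ∀ {n} (c : Colouring n) b → eCol c b ≡ sumᴱ n (λ i j → 𝟙[ c i j ≡ b ])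
eCol≡sumᴱ {n} c b = begin
  length (filter has-b (edges n))         ≡⟨ length≡sumOver-1 (filter has-b (edges n)) ⟩
  sumOver (λ _ → 1) (filter has-b (edges n)) ≡⟨ sumOver-filter has-b (λ _ → 1) (edges n) ⟩
  sumOver _ (edges n)                     ≡⟨ sumOver-edges n _ ⟩
  sumᴱ n (λ i j → 𝟙[ c i j ≡ b ])         ∎
  where
  open ≡-Reasoning
  has-b = λ (p : Edge n) → c (proj₁ p) (proj₂ p) ≟ᶜ b

sum-sgn≡⊖ : ∀ {A : Set} (col : A → Bool) xs →
  foldr _+ℤ_ 0ℤ (map (λ x → sgn (col x)) xs) ≡ sumOver (λ x → 𝟙[ col x ≡ true ]) xs ⊖ sumOver (λ x → 𝟙[ col x ≡ false ]) xs
sum-sgn≡⊖ col []       = refl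
sum-sgn≡⊖ col (x ∷ xs) with col x
... | true  = trans (cong (sgn true +ℤ_) (sum-sgn≡⊖ col xs)) (ℤ.distribʳ-⊖-+-pos 1 (#col true) (#col false))
  where #col = λ b → sumOver (λ x → 𝟙[ col x ≡ b ]) xs
... | false = trans (cong (sgn false +ℤ_) (sum-sgn≡⊖ col xs)) (ℤ.distribʳ-⊖-+-neg 0 (#col true) (#col false))
  where #col = λ b → sumOver (λ x → 𝟙[ col x ≡ b ]) xs

does-≟-true : ∀ x → does (x ≟ᶜ true) ≡ x
does-≟-true true  = refl
does-≟-true false = refl

weight≡count⊖count : ∀ {n} (c : Colouring n) (t : EdgeSet n) → weight c t ≡ count c t true ⊖ count c t false
weight≡count⊖count {n} c t =
  trans (sum-sgn≡⊖ (λ p → c (proj₁ p) (proj₂ p)) (filter in-t (edges n)))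
        (cong₂ _⊖_ (count-as-list true) (count-as-list false))
  where
  in-t = λ (p : Edge n) → t (proj₁ p) (proj₂ p) ≟ᶜ true
  count-as-list : ∀ b → sumOver (λ p → 𝟙[ c (proj₁ p) (proj₂ p) ≡ b ]) (filter in-t (edges n)) ≡ count c t b
  count-as-list b = trans (sumOver-filter in-t _ (edges n))
    (trans (sumOver-edges n _) (sumᴱ-cong λ i j → cong (λ x → when x 𝟙[ c i j ≡ b ]) (does-≟-true (t i j))))

module _ {n} {t : EdgeSet n} where

  adj-sym : ∀ {x y} → Adj t x y → Adj t y x
  adj-sym (inj₁ e) = inj₂ e
  adj-sym (inj₂ e) = inj₁ e

  adj-irrefl : ∀ {x y} → Adj t x y → x ≢ y
  adj-irrefl (inj₁ (x<y , _)) refl = <-irrefl refl x<y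
  adj-irrefl (inj₂ (y<x , _)) refl = <-irrefl refl y<x

  reach-trans : ∀ {x y z} → Reach t x y → Reach t y z → Reach t x z
  reach-trans here         r = r
  reach-trans (step a r₁) r₂ = step a (reach-trans r₁ r₂)

  reach-sym : ∀ {x y} → Reach t x y → Reach t y x
  reach-sym here       = here
  reach-sym (step a r) = reach-trans (reach-sym r) (step (adj-sym a) here)

data Position : {m : ℕ} → Fin (suc m) → Set where
  last  : ∀ {m} → Position (fromℕ m)
  inner : ∀ {m} (j : Fin m) → Position (inject₁ j)

position : ∀ {m} (i : Fin (suc m)) → Position i
position {zero}  fzero    = last
position {suc m} fzero    = inner fzero
position {suc m} (fsuc i) with position i
... | last    = last
... | inner j = inner (fsuc j)

module _ {n} {t : EdgeSet n} (cyc : Cycle t) where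
  open Cycle cyc

  cycle-neighbours : ∀ i → Σ _ λ a → Σ _ λ b → a ≢ b × Adj t (verts i) (verts a) × Adj t (verts i) (verts b)
  cycle-neighbours fzero = fsuc fzero , fromℕ (suc (suc k)) , (λ ()) , consec fzero , adj-sym {t = t} closing
  cycle-neighbours (fsuc j) with position j
  ... | last     = inject₁ j , fzero , (λ ()) , adj-sym {t = t} (consec j) , closing
  ... | inner j′ = inject₁ j , fsuc (fsuc j′) , inject₁²≢2+ , adj-sym {t = t} (consec j) , consec (fsuc j′)
    where
    inject₁²≢2+ : inject₁ (inject₁ j′) ≢ fsuc (fsuc j′)
    inject₁²≢2+ e = m≢2+m (trans (sym (trans (Fin.toℕ-inject₁ (inject₁ j′)) (Fin.toℕ-inject₁ j′))) (cong toℕ e))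
      where
      m≢2+m : ∀ {m} → m ≢ suc (suc m)
      m≢2+m ()

module _ {n} {t : EdgeSet n} where

  adj? : ∀ u v → Dec (Adj t u v)
  adj? u v = ((u Fin.<? v) ×-dec (t u v ≟ᶜ true)) ⊎-dec ((v Fin.<? u) ×-dec (t v u ≟ᶜ true))

  adj-ordered : ∀ {x y} → x <ᶠ y → Adj t x y → t x y ≡ true
  adj-ordered x<y (inj₁ (_ , e))   = e
  adj-ordered x<y (inj₂ (y<x , _)) = ⊥-elim (<-asym x<y y<x)

  walk-length : ∀ {u v} → Reach t u v → ℕ
  walk-length here       = 0
  walk-length (step _ r) = suc (walk-length r)

module PathsToCycle {n} {t : EdgeSet n} (α β : ℕ → Fin n) (a b : ℕ)
  (α-adj : ∀ i → i < a → Adj t (α i) (α (suc i)))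
  (β-adj : ∀ j → j < b → Adj t (β j) (β (suc j)))
  (α-injective : ∀ {i i′} → i ≤ a → i′ ≤ a → α i ≡ α i′ → i ≡ i′)
  (β-injective : ∀ {j j′} → j ≤ b → j′ ≤ b → β j ≡ β j′ → j ≡ j′)
  (meet-only-at-end : ∀ {i j} → i ≤ a → j ≤ b → α i ≡ β j → i ≡ a)
  (meet : α a ≡ β b) where

  private
    s = a + b

  V : ℕ → Fin n
  V x = if x ℕ.≤ᵇ a then α x else β (s ∸ x)

  V-low : ∀ {x} → x ≤ a → V x ≡ α x
  V-low x≤a rewrite Equivalence.to T-≡ (≤⇒≤ᵇ x≤a) = refl

  V-high : ∀ {x} → a ≤ x → V x ≡ β (s ∸ x)
  V-high {x} a≤x with x ℕ.≤ᵇ a in x≤ᵇa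
  ... | false = refl
  ... | true with ≤-antisym (≤ᵇ⇒≤ x a (Equivalence.from T-≡ x≤ᵇa)) a≤x
  ...   | refl = trans meet (cong β (sym (m+n∸m≡n a b)))

  high-index : ∀ {x} → a < x → x ≤ s → s ∸ x < b
  high-index {x} a<x x≤s = subst (s ∸ x <_) (m+n∸m≡n a b) (∸-monoʳ-< a<x x≤s)

  low-high-apart : ∀ {x y} → x ≤ a → a < y → y ≤ s → V x ≢ V y
  low-high-apart {x} {y} x≤a a<y y≤s Vx≡Vy = <-irrefl s∸y≡b (high-index a<y y≤s)
    where
    αx≡βs∸y : α x ≡ β (s ∸ y)
    αx≡βs∸y = trans (sym (V-low x≤a)) (trans Vx≡Vy (V-high (<⇒≤ a<y)))
    s∸y≡b : s ∸ y ≡ b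
    s∸y≡b = β-injective (<⇒≤ (high-index a<y y≤s)) ≤-refl
              (trans (sym αx≡βs∸y) (trans (cong α (meet-only-at-end x≤a (<⇒≤ (high-index a<y y≤s)) αx≡βs∸y)) meet))

  V-injective : ∀ {x y} → x ≤ s → y ≤ s → V x ≡ V y → x ≡ y
  V-injective {x} {y} x≤s y≤s Vx≡Vy with x ≤? a | y ≤? a
  ... | yes x≤a | yes y≤a = α-injective x≤a y≤a (trans (sym (V-low x≤a)) (trans Vx≡Vy (V-low y≤a)))
  ... | yes x≤a | no  y≰a = ⊥-elim (low-high-apart x≤a (≰⇒> y≰a) y≤s Vx≡Vy)
  ... | no  x≰a | yes y≤a = ⊥-elim (low-high-apart y≤a (≰⇒> x≰a) x≤s (sym Vx≡Vy))
  ... | no  x≰a | no  y≰a = ∸-cancelˡ-≡ x≤s y≤s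
        (β-injective (<⇒≤ (high-index (≰⇒> x≰a) x≤s)) (<⇒≤ (high-index (≰⇒> y≰a) y≤s))
                     (trans (sym (V-high (<⇒≤ (≰⇒> x≰a)))) (trans Vx≡Vy (V-high (<⇒≤ (≰⇒> y≰a))))))

  V-adj : ∀ {x} → x < s → Adj t (V x) (V (suc x))
  V-adj {x} x<s with suc x ≤? a
  ... | yes 1+x≤a = subst₂ (Adj t) (sym (V-low (<⇒≤ 1+x≤a))) (sym (V-low 1+x≤a)) (α-adj x 1+x≤a)
  ... | no  1+x≰a = subst₂ (Adj t) (sym (trans (V-high (s≤s⁻¹ (≰⇒> 1+x≰a))) (cong β (+-∸-assoc 1 x<s))))
                                   (sym (V-high (<⇒≤ (≰⇒> 1+x≰a))))
                                   (adj-sym {t = t} (β-adj (s ∸ suc x) (high-index (≰⇒> 1+x≰a) x<s)))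

  cycle : Adj t (β 0) (α 0) → 2 ≤ s → Cycle t
  cycle closing 2≤s = record
    { k        = k
    ; verts    = V ∘ toℕ
    ; distinct = λ {x} {y} → Fin.toℕ-injective ∘ V-injective (bound x) (bound y)
    ; consec   = λ i → subst (λ x → Adj t (V x) (V (suc (toℕ i)))) (sym (Fin.toℕ-inject₁ i))
                             (V-adj (subst (toℕ i <_) (sym s≡2+k) (Fin.toℕ<n i)))
    ; closing  = subst (λ x → Adj t (V x) (V 0)) (trans s≡2+k (sym (Fin.toℕ-fromℕ (suc (suc k)))))
                       (subst₂ (Adj t) (sym V-end) (sym (V-low z≤n)) closing)
    }
    where
    k = s ∸ 2
    s≡2+k : s ≡ suc (suc k)
    s≡2+k = sym (m+[n∸m]≡n 2≤s)
    bound : ∀ (x : Fin (suc (suc (suc k)))) → toℕ x ≤ s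
    bound x = subst (toℕ x ≤_) (sym s≡2+k) (s≤s⁻¹ (Fin.toℕ<n x))
    V-end : V s ≡ β 0
    V-end = trans (V-high (m≤m+n a b)) (cong β (n∸n≡0 s))

argmax-exists : ∀ {m} (f : Fin (suc m) → ℕ) → Σ (Fin (suc m)) λ i → ∀ j → f j ≤ f i
argmax-exists {m} f = argmax f fzero (allFin (suc m)) ,
  λ j → All.lookup (f[xs]≤f[argmax] {f = f} fzero (allFin (suc m))) (∈-allFin j)

record IsParentMap {n} (height : Fin (suc n) → ℕ) (parent : Fin (suc n) → Fin (suc n)) : Set where
  field
    parent-root  : parent fzero ≡ fzero
    parent-lower : ∀ v → v ≢ fzero → height (parent v) < height v

treeEdges : ∀ {n} → (Fin (suc n) → Fin (suc n)) → EdgeSet (suc n)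
treeEdges p i j = p j ≡ᵇ i ∨ p i ≡ᵇ j

parent-edge∈treeEdges : ∀ {n} (p : Fin (suc n) → Fin (suc n)) {i j} → p i ≡ j ⊎ p j ≡ i → treeEdges p i j ≡ true
parent-edge∈treeEdges p {i} {j} (inj₁ pi≡j) = trans (cong (p j ≡ᵇ i ∨_) (dec-true (p i Fin.≟ j) pi≡j)) (∨-zeroʳ _)
parent-edge∈treeEdges p {i} {j} (inj₂ pj≡i) = cong (_∨ p i ≡ᵇ j) (dec-true (p j Fin.≟ i) pj≡i)

module ParentMap {n} {h : Fin (suc n) → ℕ} {p : Fin (suc n) → Fin (suc n)} (P : IsParentMap h p) where
  open IsParentMap P

  parent-induction : (Q : Fin (suc n) → Set) → Q fzero → (∀ v → v ≢ fzero → Q (p v) → Q v) → ∀ v → Q v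
  parent-induction Q base ind v = go (suc (h v)) v ≤-refl
    where
    go : ∀ m v → h v < m → Q v
    go (suc m) v (s≤s hv≤m) with v Fin.≟ fzero
    ... | yes refl = base
    ... | no v≢0   = ind v v≢0 (go m (p v) (≤-trans (parent-lower v v≢0) hv≤m))

  parent-≢ : ∀ v → v ≢ fzero → p v ≢ v
  parent-≢ v v≢0 pv≡v = <-irrefl (cong h pv≡v) (parent-lower v v≢0)

  height-root-least : ∀ v → v ≢ fzero → h fzero < h v
  height-root-least = parent-induction (λ v → v ≢ fzero → h fzero < h v) (λ 0≢0 → ⊥-elim (0≢0 refl)) via-parent
    where
    via-parent : ∀ v → v ≢ fzero → (p v ≢ fzero → h fzero < h (p v)) → v ≢ fzero → h fzero < h v
    via-parent v v≢0 ih _ with p v Fin.≟ fzero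
    ... | yes pv≡0 = subst (λ u → h u < h v) pv≡0 (parent-lower v v≢0)
    ... | no pv≢0  = <-trans (ih pv≢0) (parent-lower v v≢0)

  no-2-cycle : ∀ {i j} → p j ≡ i → p i ≡ j → i ≡ j
  no-2-cycle {i} {j} pj≡i pi≡j with i Fin.≟ fzero | j Fin.≟ fzero
  ... | yes refl | _        = trans (sym parent-root) pi≡j
  ... | no _     | yes refl = sym (trans (sym parent-root) pj≡i)
  ... | no i≢0   | no j≢0   = ⊥-elim (<-asym (subst (λ u → h u < h j) pj≡i (parent-lower j j≢0))
                                                (subst (λ u → h u < h i) pi≡j (parent-lower i i≢0)))

  adj-parent : ∀ v → v ≢ fzero → Adj (treeEdges p) v (p v)
  adj-parent v v≢0 with Fin.<-cmp v (p v)
  ... | tri< v<pv _ _ = inj₁ (v<pv , parent-edge∈treeEdges p (inj₁ refl))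
  ... | tri≈ _ v≡pv _ = ⊥-elim (parent-≢ v v≢0 (sym v≡pv))
  ... | tri> _ _ pv<v = inj₂ (pv<v , parent-edge∈treeEdges p (inj₂ refl))

  adj-treeEdges : ∀ {x y} → Adj (treeEdges p) x y → p x ≡ y ⊎ p y ≡ x
  adj-treeEdges {x} {y} (inj₁ (_ , e)) with ∨-true (p y ≡ᵇ x) (p x ≡ᵇ y) e
  ... | inj₁ py≡x = inj₂ (from-does (p y Fin.≟ x) py≡x)
  ... | inj₂ px≡y = inj₁ (from-does (p x Fin.≟ y) px≡y)
  adj-treeEdges {x} {y} (inj₂ (_ , e)) with ∨-true (p x ≡ᵇ y) (p y ≡ᵇ x) e
  ... | inj₁ px≡y = inj₁ (from-does (p x Fin.≟ y) px≡y)
  ... | inj₂ py≡x = inj₂ (from-does (p y Fin.≟ x) py≡x)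

  adj-lower⇒parent : ∀ {x y} → Adj (treeEdges p) x y → h y ≤ h x → p x ≡ y
  adj-lower⇒parent {x} {y} a hy≤hx with adj-treeEdges a
  ... | inj₁ px≡y = px≡y
  ... | inj₂ py≡x with y Fin.≟ fzero
  ...   | yes refl = ⊥-elim (adj-irrefl {t = treeEdges p} a (trans (sym py≡x) parent-root))
  ...   | no y≢0   = ⊥-elim (<⇒≱ (subst (λ u → h u < h y) py≡x (parent-lower y y≢0)) hy≤hx)

  connected : Connected (treeEdges p)
  connected u v = reach-trans (to-root u) (reach-sym (to-root v))
    where
    to-root : ∀ v → Reach (treeEdges p) v fzero
    to-root = parent-induction (λ v → Reach (treeEdges p) v fzero) here (λ v v≢0 r → step (adj-parent v v≢0) r)

  -- A highest vertex of a cycle would have two distinct neighbours, both of them its parent.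
  acyclic : Acyclic (treeEdges p)
  acyclic cyc = top-has-one-neighbour (argmax-exists (λ i → h (verts i)))
    where
    open Cycle cyc
    top-has-one-neighbour : (Σ _ λ top → ∀ i → h (verts i) ≤ h (verts top)) → ⊥
    top-has-one-neighbour (top , highest) with cycle-neighbours cyc top
    ... | a , b , a≢b , adj-a , adj-b =
      a≢b (distinct (trans (sym (adj-lower⇒parent adj-a (highest a))) (adj-lower⇒parent adj-b (highest b))))

  spanningTree : SpanningTree (treeEdges p)
  spanningTree = connected , acyclic

coloured : ∀ {n} → Colouring n → Bool → Fin n → Fin n → ℕ
coloured c b u v = when (u <ᵇ v) 𝟙[ c u v ≡ b ] + when (v <ᵇ u) 𝟙[ c v u ≡ b ]

𝟙-complement : ∀ x b → 𝟙[ x ≡ b ] + 𝟙[ x ≡ not b ] ≡ 1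
𝟙-complement true  true  = refl
𝟙-complement true  false = refl
𝟙-complement false true  = refl
𝟙-complement false false = refl

coloured-complement : ∀ {n} (c : Colouring n) b {u v} → u ≢ v → coloured c b u v + coloured c (not b) u v ≡ 1
coloured-complement c b {u} {v} u≢v with Fin.<-cmp u v
... | tri< u<v _ v≮u rewrite dec-true (u Fin.<? v) u<v | dec-false (v Fin.<? u) v≮u =
  trans (cong₂ _+_ (+-identityʳ 𝟙[ c u v ≡ b ]) (+-identityʳ 𝟙[ c u v ≡ not b ])) (𝟙-complement (c u v) b)
... | tri≈ _ u≡v _ = ⊥-elim (u≢v u≡v)
... | tri> u≮v _ v<u rewrite dec-false (u Fin.<? v) u≮v | dec-true (v Fin.<? u) v<u = 𝟙-complement (c v u) b

coloured-loop : ∀ {n} (c : Colouring n) b u → coloured c b u u ≡ 0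
coloured-loop c b u rewrite dec-false (u Fin.<? u) (<-irrefl refl) = refl

coloured-≤1 : ∀ {n} (c : Colouring n) b u v → coloured c b u v ≤ 1
coloured-≤1 c b u v with u Fin.≟ v
... | yes refl = subst (_≤ 1) (sym (coloured-loop c b u)) z≤n
... | no u≢v   = m+n≤o⇒m≤o _ (≤-reflexive (coloured-complement c b u≢v))

treeCount : ∀ {n} → Colouring (suc n) → Bool → (Fin (suc n) → Fin (suc n)) → ℕ
treeCount {n} c b p = ∑[ v < suc n ] coloured c b (p v) v

module TreeCount {n} {h : Fin (suc n) → ℕ} {p : Fin (suc n) → Fin (suc n)} (P : IsParentMap h p)
                 (c : Colouring (suc n)) where
  open IsParentMap P
  open ParentMap P

  private
    N = suc n

  count-treeEdges : ∀ b → count c (treeEdges p) b ≡ treeCount c b p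
  count-treeEdges b = begin
    count c (treeEdges p) b
      ≡⟨ sum-cong-≗ (λ i → trans (sum-cong-≗ (split i)) (∑-distrib-+ (down i) (up i))) ⟩
    ∑[ i < N ] (∑[ j < N ] down i j + ∑[ j < N ] up i j)
      ≡⟨ ∑-distrib-+ (λ i → ∑[ j < N ] down i j) (λ i → ∑[ j < N ] up i j) ⟩
    ∑[ i < N ] ∑[ j < N ] down i j + ∑[ i < N ] ∑[ j < N ] up i j
      ≡⟨ cong₂ _+_ (trans (∑-comm down) (sum-cong-≗ down-at)) (sum-cong-≗ up-at) ⟩
    ∑[ v < N ] when (p v <ᵇ v) (X (p v) v) + ∑[ v < N ] when (v <ᵇ p v) (X v (p v))
      ≡⟨ ∑-distrib-+ (λ v → when (p v <ᵇ v) (X (p v) v)) (λ v → when (v <ᵇ p v) (X v (p v))) ⟨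
    treeCount c b p ∎
    where
    open ≡-Reasoning
    X : Fin N → Fin N → ℕ
    X i j = 𝟙[ c i j ≡ b ]
    down up : Fin N → Fin N → ℕ
    down i j = when (i <ᵇ j) (when (p j ≡ᵇ i) (X i j))
    up   i j = when (i <ᵇ j) (when (p i ≡ᵇ j) (X i j))
    split : ∀ i j → when (i <ᵇ j) (when (treeEdges p i j) (X i j)) ≡ down i j + up i j
    split i j with i <ᵇ j in i<j
    ... | false = refl
    ... | true with p j ≡ᵇ i in pj≡i | p i ≡ᵇ j in pi≡j
    ...   | true  | true  = ⊥-elim (<-irrefl (cong toℕ (no-2-cycle (from-does (p j Fin.≟ i) pj≡i)
                                                                      (from-does (p i Fin.≟ j) pi≡j)))
                                            (from-does (i Fin.<? j) i<j))
    ...   | true  | false = sym (+-identityʳ _)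
    ...   | false | true  = refl
    ...   | false | false = refl
    down-at : ∀ j → ∑[ i < N ] down i j ≡ when (p j <ᵇ j) (X (p j) j)
    down-at j = trans (sum-cong-≗ λ i → when-comm (i <ᵇ j) (p j ≡ᵇ i) (X i j))
                      (∑-when-≡ᵇ (p j) (λ i → when (i <ᵇ j) (X i j)))
    up-at : ∀ i → ∑[ j < N ] up i j ≡ when (i <ᵇ p i) (X i (p i))
    up-at i = trans (sum-cong-≗ λ j → when-comm (i <ᵇ j) (p i ≡ᵇ j) (X i j))
                    (∑-when-≡ᵇ (p i) (λ j → when (i <ᵇ j) (X i j)))

  weight-treeEdges : weight c (treeEdges p) ≡ treeCount c true p ⊖ treeCount c false p
  weight-treeEdges = trans (weight≡count⊖count c (treeEdges p))
                           (cong₂ _⊖_ (count-treeEdges true) (count-treeEdges false))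

  treeCount-total : treeCount c true p + treeCount c false p + 1 ≡ N
  treeCount-total = begin
    treeCount c true p + treeCount c false p + 1
      ≡⟨ cong (treeCount c true p + treeCount c false p +_) (∑-when-≡ᵇ {N} fzero (λ _ → 1)) ⟨
    treeCount c true p + treeCount c false p + ∑[ v < N ] root v
      ≡⟨ cong (_+ ∑[ v < N ] root v) (∑-distrib-+ (λ v → pos v) (λ v → neg v)) ⟨
    ∑[ v < N ] (pos v + neg v) + ∑[ v < N ] root v
      ≡⟨ ∑-distrib-+ (λ v → pos v + neg v) root ⟨
    ∑[ v < N ] (pos v + neg v + root v)
      ≡⟨ sum-cong-≗ one-parent-edge ⟩
    ∑[ v < N ] 1
      ≡⟨ ∑-const-1 N ⟩
    N ∎
    where
    open ≡-Reasoning
    pos neg root : Fin N → ℕ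
    pos v = coloured c true (p v) v
    neg v = coloured c false (p v) v
    root v = when (fzero ≡ᵇ v) 1
    one-parent-edge : ∀ v → pos v + neg v + root v ≡ 1
    one-parent-edge v with v Fin.≟ fzero
    ... | yes refl rewrite parent-root = refl
    ... | no v≢0 rewrite dec-false (fzero Fin.≟ v) (λ 0≡v → v≢0 (sym 0≡v)) =
      trans (+-identityʳ _) (coloured-complement c true (parent-≢ v v≢0))

-- The greedy tree

_[_↦_] : ∀ {n} {A : Set} → (Fin n → A) → Fin n → A → Fin n → A
(f [ v ↦ x ]) w = if v ≡ᵇ w then x else f w

update-same : ∀ {n} {A : Set} (f : Fin n → A) v x → (f [ v ↦ x ]) v ≡ x
update-same f v x rewrite ≡ᵇ-refl v = refl

update-other : ∀ {n} {A : Set} (f : Fin n → A) {v w} x → v ≢ w → (f [ v ↦ x ]) w ≡ f w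
update-other f {v} {w} x v≢w rewrite dec-false (v Fin.≟ w) v≢w = refl

when-insert : ∀ {n} (S : Fin n → Bool) {v} → S v ≡ false → ∀ w x →
              when ((S [ v ↦ true ]) w) x ≡ when (v ≡ᵇ w) x + when (S w) x
when-insert S {v} v∉S w x with v Fin.≟ w
... | yes refl rewrite v∉S = sym (+-identityʳ x)
... | no _     = refl

∑-insert : ∀ {n} (S : Fin n → Bool) {v} → S v ≡ false → (F : Fin n → ℕ) →
           ∑[ w < n ] when ((S [ v ↦ true ]) w) (F w) ≡ F v + ∑[ w < n ] when (S w) (F w)
∑-insert {n} S {v} v∉S F = trans (sum-cong-≗ λ w → when-insert S v∉S w (F w))
                           (trans (∑-distrib-+ (λ w → when (v ≡ᵇ w) (F w)) (λ w → when (S w) (F w)))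
                                  (cong (_+ ∑[ w < n ] when (S w) (F w)) (∑-when-≡ᵇ v F)))

size : ∀ {n} → (Fin n → Bool) → ℕ
size {n} S = ∑[ w < n ] when (S w) 1

size-insert : ∀ {n} (S : Fin n → Bool) {v} → S v ≡ false → size (S [ v ↦ true ]) ≡ suc (size S)
size-insert S v∉S = ∑-insert S v∉S (λ _ → 1)

size-≤ : ∀ {n} (S : Fin n → Bool) → size S ≤ n
size-≤ {n} S = subst (size S ≤_) (∑-const-1 n) (∑-mono-≤ λ w → when≤ (S w))
  where
  when≤ : ∀ a → when a 1 ≤ 1
  when≤ true  = ≤-refl
  when≤ false = z≤n

size-all : ∀ {n} (S : Fin n → Bool) → (∀ w → S w ≡ true) → size S ≡ n
size-all {n} S all = trans (sum-cong-≗ λ w → cong (λ a → when a 1) (all w)) (∑-const-1 n)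

inside : ∀ {n} → Colouring n → Bool → (Fin n → Bool) → ℕ
inside {n} c b S = sumᴱ n (λ i j → when (S i) (when (S j) 𝟙[ c i j ≡ b ]))

when-insert² : ∀ {n} (S : Fin n → Bool) {v} → S v ≡ false → ∀ i j x →
  when ((S [ v ↦ true ]) i) (when ((S [ v ↦ true ]) j) x) ≡
  (when (v ≡ᵇ i) (when (v ≡ᵇ j) x) + when (v ≡ᵇ i) (when (S j) x)) + (when (S i) (when (v ≡ᵇ j) x) + when (S i) (when (S j) x))
when-insert² S {v} v∉S i j x = begin
  when (S′ i) (when (S′ j) x)
    ≡⟨ when-insert S v∉S i _ ⟩
  when (v ≡ᵇ i) (when (S′ j) x) + when (S i) (when (S′ j) x)
    ≡⟨ cong₂ (λ y z → when (v ≡ᵇ i) y + when (S i) z) (when-insert S v∉S j x) (when-insert S v∉S j x) ⟩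
  when (v ≡ᵇ i) (when (v ≡ᵇ j) x + when (S j) x) + when (S i) (when (v ≡ᵇ j) x + when (S j) x)
    ≡⟨ cong₂ _+_ (when-+ (v ≡ᵇ i) _ _) (when-+ (S i) _ _) ⟩
  (when (v ≡ᵇ i) (when (v ≡ᵇ j) x) + when (v ≡ᵇ i) (when (S j) x)) + (when (S i) (when (v ≡ᵇ j) x) + when (S i) (when (S j) x)) ∎
  where
  open ≡-Reasoning
  S′ = S [ v ↦ true ]

sumᴱ-loop : ∀ {n} (v : Fin n) (X : Fin n → Fin n → ℕ) → sumᴱ n (λ i j → when (v ≡ᵇ i) (when (v ≡ᵇ j) (X i j))) ≡ 0
sumᴱ-loop v X = trans (sumᴱ-from v _)
               (trans (sum-cong-≗ λ j → when-comm (v <ᵇ j) (v ≡ᵇ j) _)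
               (trans (∑-when-≡ᵇ v (λ j → when (v <ᵇ j) (X v j)))
                      (cong (λ a → when a (X v v)) (dec-false (v Fin.<? v) (<-irrefl refl)))))

∑-when-coloured : ∀ {n} (c : Colouring n) b (S : Fin n → Bool) v →
  ∑[ w < n ] when (S w) (coloured c b w v) ≡
  ∑[ w < n ] when (w <ᵇ v) (when (S w) 𝟙[ c w v ≡ b ]) + ∑[ w < n ] when (v <ᵇ w) (when (S w) 𝟙[ c v w ≡ b ])
∑-when-coloured c b S v =
  trans (sum-cong-≗ λ w → trans (when-+ (S w) _ _) (cong₂ _+_ (when-comm (S w) (w <ᵇ v) _) (when-comm (S w) (v <ᵇ w) _)))
        (∑-distrib-+ (λ w → when (w <ᵇ v) (when (S w) 𝟙[ c w v ≡ b ])) (λ w → when (v <ᵇ w) (when (S w) 𝟙[ c v w ≡ b ])))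

inside-insert : ∀ {n} (c : Colouring n) b (S : Fin n → Bool) {v} → S v ≡ false →
                inside c b (S [ v ↦ true ]) ≡ inside c b S + ∑[ w < n ] when (S w) (coloured c b w v)
inside-insert {n} c b S {v} v∉S = begin
  inside c b (S [ v ↦ true ])
    ≡⟨ sumᴱ-cong (λ i j → when-insert² S v∉S i j (X i j)) ⟩
  sumᴱ n (λ i j → (vv i j + vS i j) + (Sv i j + SS i j))
    ≡⟨ trans (sumᴱ-+ (λ i j → vv i j + vS i j) (λ i j → Sv i j + SS i j)) (cong₂ _+_ (sumᴱ-+ vv vS) (sumᴱ-+ Sv SS)) ⟩
  (sumᴱ n vv + sumᴱ n vS) + (sumᴱ n Sv + sumᴱ n SS)
    ≡⟨ cong₂ _+_ (cong₂ _+_ (sumᴱ-loop v X) (sumᴱ-from v (λ i j → when (S j) (X i j))))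
                 (cong (_+ inside c b S) (trans (sumᴱ-cong λ i j → when-comm (S i) (v ≡ᵇ j) (X i j))
                                                (sumᴱ-to v (λ i j → when (S i) (X i j))))) ⟩
  from-v + (to-v + inside c b S)
    ≡⟨ trans (+-comm from-v _) (trans (cong (_+ from-v) (+-comm to-v _)) (+-assoc (inside c b S) to-v from-v)) ⟩
  inside c b S + (to-v + from-v)
    ≡⟨ cong (inside c b S +_) (∑-when-coloured c b S v) ⟨
  inside c b S + ∑[ w < n ] when (S w) (coloured c b w v) ∎
  where
  open ≡-Reasoning
  X vv vS Sv SS : Fin n → Fin n → ℕ
  X i j = 𝟙[ c i j ≡ b ]
  vv i j = when (v ≡ᵇ i) (when (v ≡ᵇ j) (X i j))
  vS i j = when (v ≡ᵇ i) (when (S j) (X i j))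
  Sv i j = when (S i) (when (v ≡ᵇ j) (X i j))
  SS i j = when (S i) (when (S j) (X i j))
  from-v to-v : ℕ
  from-v = ∑[ w < n ] when (v <ᵇ w) (when (S w) 𝟙[ c v w ≡ b ])
  to-v   = ∑[ w < n ] when (w <ᵇ v) (when (S w) 𝟙[ c w v ≡ b ])

∈-insert : ∀ {n} (S : Fin n → Bool) v {w} → S w ≡ true → (S [ v ↦ true ]) w ≡ true
∈-insert S v {w} w∈S with v ≡ᵇ w
... | true  = refl
... | false = w∈S

size-missing : ∀ {n} (S : Fin n → Bool) {v} → S v ≡ false → size S < n
size-missing S {v} v∉S = subst (_≤ _) (size-insert S v∉S) (size-≤ (S [ v ↦ true ]))

suc-C-2 : ∀ m → suc m C 2 ≡ m + m C 2
suc-C-2 m = trans (sym (nCk+nC[k+1]≡[n+1]C[k+1] m 1)) (cong (_+ m C 2) (nC1≡n m))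

∉∈⇒≢ : ∀ {n} (S : Fin n → Bool) {x y} → S x ≡ false → S y ≡ true → x ≢ y
∉∈⇒≢ S x∉S y∈S refl with () ← trans (sym x∉S) y∈S

module Greedy {n} (c : Colouring (suc n)) (b : Bool) where
  private
    N = suc n

  good bad : Fin N → Fin N → ℕ
  good = coloured c b
  bad  = coloured c (not b)

  record PartialTree : Set where
    field
      S      : Fin N → Bool
      parent : Fin N → Fin N
      height : Fin N → ℕ
      root∈S       : S fzero ≡ true
      parent-root  : parent fzero ≡ fzero
      parent∈S     : ∀ v → S v ≡ true → S (parent v) ≡ true
      parent-lower : ∀ v → S v ≡ true → v ≢ fzero → height (parent v) < height v
      height<size  : ∀ v → S v ≡ true → height v < size S

  open PartialTree

  badEdges : PartialTree → ℕ
  badEdges T = ∑[ v < N ] when (S T v) (bad (parent T v) v)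

  module _ (T : PartialTree) {u v} (u∈S : S T u ≡ true) (v∉S : S T v ≡ false) where

    private
      fresh : ∀ {w} → S T w ≡ true → v ≢ w
      fresh = ∉∈⇒≢ (S T) v∉S

      S′ = S T [ v ↦ true ]
      parent′ = parent T [ v ↦ u ]
      height′ = height T [ v ↦ size (S T) ]

      was-in-S : ∀ {w} → v ≢ w → S′ w ≡ true → S T w ≡ true
      was-in-S v≢w w∈S′ = trans (sym (update-other (S T) true v≢w)) w∈S′

      parent∈S′ : ∀ w → S′ w ≡ true → S′ (parent′ w) ≡ true
      parent∈S′ w = cases w (v Fin.≟ w)
        where
        cases : ∀ w → Dec (v ≡ w) → S′ w ≡ true → S′ (parent′ w) ≡ true
        cases w (yes refl) _ rewrite update-same (parent T) v u = ∈-insert (S T) v u∈S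
        cases w (no v≢w) w∈S′ rewrite update-other (parent T) u v≢w =
          ∈-insert (S T) v (parent∈S T w (was-in-S v≢w w∈S′))

      parent-lower′ : ∀ w → S′ w ≡ true → w ≢ fzero → height′ (parent′ w) < height′ w
      parent-lower′ w = cases w (v Fin.≟ w)
        where
        cases : ∀ w → Dec (v ≡ w) → S′ w ≡ true → w ≢ fzero → height′ (parent′ w) < height′ w
        cases w (yes refl) _ _ rewrite update-same (parent T) v u | update-same (height T) v (size (S T))
                                     | update-other (height T) (size (S T)) (fresh u∈S) = height<size T u u∈S
        cases w (no v≢w) w∈S′ w≢0 rewrite update-other (parent T) u v≢w | update-other (height T) (size (S T)) v≢w
                                        | update-other (height T) (size (S T)) (fresh (parent∈S T w (was-in-S v≢w w∈S′))) =
          parent-lower T w (was-in-S v≢w w∈S′) w≢0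

      height<size′ : ∀ w → S′ w ≡ true → height′ w < size S′
      height<size′ w rewrite size-insert (S T) v∉S = cases w (v Fin.≟ w)
        where
        cases : ∀ w → Dec (v ≡ w) → S′ w ≡ true → height′ w < suc (size (S T))
        cases w (yes refl) _ rewrite update-same (height T) v (size (S T)) = ≤-refl
        cases w (no v≢w) w∈S′ rewrite update-other (height T) (size (S T)) v≢w =
          m<n⇒m<1+n (height<size T w (was-in-S v≢w w∈S′))

    grow : PartialTree
    grow = record
      { S            = S′
      ; parent       = parent′
      ; height       = height′
      ; root∈S       = ∈-insert (S T) v (root∈S T)
      ; parent-root  = trans (update-other (parent T) u (fresh (root∈S T))) (parent-root T)
      ; parent∈S     = parent∈S′
      ; parent-lower = parent-lower′
      ; height<size  = height<size′
      }

    grow-size : size (S grow) ≡ suc (size (S T))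
    grow-size = size-insert (S T) v∉S

    grow-badEdges : badEdges grow ≡ bad u v + badEdges T
    grow-badEdges = trans (∑-insert (S T) v∉S (λ w → bad (parent′ w) w))
                          (cong₂ _+_ (cong (λ x → bad x v) (update-same (parent T) v u)) (sum-cong-≗ same-parent))
      where
      same-parent : ∀ w → when (S T w) (bad (parent′ w) w) ≡ when (S T w) (bad (parent T w) w)
      same-parent w with S T w in w∈S
      ... | true  = cong (λ x → bad x w) (update-other (parent T) u (fresh w∈S))
      ... | false = refl

    grow-inside : inside c b (S grow) ≡ inside c b (S T) + ∑[ w < N ] when (S T w) (good w v)
    grow-inside = inside-insert c b (S T) v∉S

  -- B is the vertex set of the tree at the last jump.
  record Stage : Set where
    field
      tree      : PartialTree
      B         : Fin N → Bool
      jumps     : ℕ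
      B⊆S       : ∀ v → B v ≡ true → S tree v ≡ true
      B-closed  : ∀ x y → B x ≡ true → B y ≡ false → good x y ≡ 0
      jumps≤|B| : jumps ≤ size B
      |B|<|S|   : size B < size (S tree)
      few-bad   : badEdges tree ≤ jumps
      few-good  : inside c b (S tree) ≤ (size (S tree) ∸ jumps) C 2

  open Stage

  good-edges-to-new : (st : Stage) → ∀ {v} → S (tree st) v ≡ false →
                      ∑[ w < N ] when (S (tree st) w) (good w v) ≤ size (S (tree st)) ∸ jumps st
  good-edges-to-new st {v} v∉S = begin
    ∑[ w < N ] when (R w) (good w v)                            ≤⟨ ∑-mono-≤ only-outside-B ⟩
    ∑[ w < N ] when (R w) (when (not (B st w)) 1)               ≡⟨ m+n∸n≡m _ (size (B st)) ⟨
    ∑[ w < N ] when (R w) (when (not (B st w)) 1) + size (B st) ∸ size (B st)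
      ≡⟨ cong (_∸ size (B st)) (trans (sym (∑-distrib-+ (λ w → when (R w) (when (not (B st w)) 1)) (λ w → when (B st w) 1)))
                                      (sum-cong-≗ R-splits)) ⟩
    size R ∸ size (B st)                                        ≤⟨ ∸-monoʳ-≤ (size R) (jumps≤|B| st) ⟩
    size R ∸ jumps st                                           ∎
    where
    open ≤-Reasoning
    R = S (tree st)
    v∉B : B st v ≡ false
    v∉B with B st v in v∈B
    ... | true  with () ← trans (sym v∉S) (B⊆S st v v∈B)
    ... | false = refl
    only-outside-B : ∀ w → when (R w) (good w v) ≤ when (R w) (when (not (B st w)) 1)
    only-outside-B w with R w | B st w in w∈B
    ... | false | _     = z≤n
    ... | true  | true  = ≤-reflexive (B-closed st w v w∈B v∉B)
    ... | true  | false = coloured-≤1 c b w v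
    R-splits : ∀ w → when (R w) (when (not (B st w)) 1) + when (B st w) 1 ≡ when (R w) 1
    R-splits w with R w in w∈S | B st w in w∈B
    ... | true  | true  = refl
    ... | true  | false = refl
    ... | false | true  with () ← trans (sym w∈S) (B⊆S st w w∈B)
    ... | false | false = refl

  attach : (st : Stage) → ∀ {u v} (u∈S : S (tree st) u ≡ true) (v∉S : S (tree st) v ≡ false) →
           bad u v ≡ 0 → Stage
  attach st {u} {v} u∈S v∉S bad≡0 = record
    { tree      = grow T u∈S v∉S
    ; B         = B st
    ; jumps     = k
    ; B⊆S       = λ w w∈B → ∈-insert (S T) v (B⊆S st w w∈B)
    ; B-closed  = B-closed st
    ; jumps≤|B| = jumps≤|B| st
    ; |B|<|S|   = subst (size (B st) <_) (sym (grow-size T u∈S v∉S)) (m<n⇒m<1+n (|B|<|S| st))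
    ; few-bad   = subst (_≤ k) (sym (trans (grow-badEdges T u∈S v∉S) (cong (_+ badEdges T) bad≡0))) (few-bad st)
    ; few-good  = subst₂ (λ e s → e ≤ (s ∸ k) C 2) (sym (grow-inside T u∈S v∉S)) (sym (grow-size T u∈S v∉S)) bound
    }
    where
    T = tree st
    k = jumps st
    k≤|S| : k ≤ size (S T)
    k≤|S| = ≤-trans (jumps≤|B| st) (<⇒≤ (|B|<|S| st))
    bound : inside c b (S T) + ∑[ w < N ] when (S T w) (good w v) ≤ (suc (size (S T)) ∸ k) C 2
    bound = begin
      inside c b (S T) + ∑[ w < N ] when (S T w) (good w v) ≤⟨ +-mono-≤ (few-good st) (good-edges-to-new st v∉S) ⟩
      (size (S T) ∸ k) C 2 + (size (S T) ∸ k)              ≡⟨ +-comm _ (size (S T) ∸ k) ⟩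
      (size (S T) ∸ k) + (size (S T) ∸ k) C 2              ≡⟨ suc-C-2 (size (S T) ∸ k) ⟨
      suc (size (S T) ∸ k) C 2                             ≡⟨ cong (_C 2) (+-∸-assoc 1 k≤|S|) ⟨
      (suc (size (S T)) ∸ k) C 2                           ∎
      where open ≤-Reasoning

  jump : (st : Stage) → ∀ {v} (v∉S : S (tree st) v ≡ false) →
         (∀ x y → S (tree st) x ≡ true → S (tree st) y ≡ false → good x y ≡ 0) → Stage
  jump st {v} v∉S cut = record
    { tree      = grow T (root∈S T) v∉S
    ; B         = S T
    ; jumps     = suc k
    ; B⊆S       = λ w w∈S → ∈-insert (S T) v w∈S
    ; B-closed  = cut
    ; jumps≤|B| = <-≤-trans (s≤s (jumps≤|B| st)) (|B|<|S| st)
    ; |B|<|S|   = subst (size (S T) <_) (sym (grow-size T (root∈S T) v∉S)) ≤-refl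
    ; few-bad   = subst (_≤ suc k) (sym (grow-badEdges T (root∈S T) v∉S)) (+-mono-≤ (coloured-≤1 c (not b) fzero v) (few-bad st))
    ; few-good  = subst₂ (λ e s → e ≤ (s ∸ suc k) C 2) (sym (grow-inside T (root∈S T) v∉S)) (sym (grow-size T (root∈S T) v∉S))
                         (subst (_≤ (size (S T) ∸ k) C 2) (sym (trans (cong (inside c b (S T) +_) no-good-edges) (+-identityʳ _)))
                                (few-good st))
    }
    where
    T = tree st
    k = jumps st
    no-good-edges : ∑[ w < N ] when (S T w) (good w v) ≡ 0
    no-good-edges = ∑-zero crossing
      where
      crossing : ∀ w → when (S T w) (good w v) ≡ 0
      crossing w with S T w in w∈S
      ... | true  = cut w v w∈S v∉S
      ... | false = refl

  private
    ∅ S₀ : Fin N → Bool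
    ∅ _ = false
    S₀  = ∅ [ fzero ↦ true ]

    |∅|≡0 : size ∅ ≡ 0
    |∅|≡0 = sum-replicate-zero N

    |S₀|≡1 : size S₀ ≡ 1
    |S₀|≡1 = trans (size-insert ∅ {fzero} refl) (cong suc |∅|≡0)

  root-only : PartialTree
  root-only = record
    { S            = S₀
    ; parent       = λ _ → fzero
    ; height       = λ _ → 0
    ; root∈S       = root∈S₀
    ; parent-root  = refl
    ; parent∈S     = λ _ _ → root∈S₀
    ; parent-lower = λ w w∈S₀ w≢0 → ⊥-elim (w≢0 (only-root w w∈S₀))
    ; height<size  = λ _ _ → subst (0 <_) (sym |S₀|≡1) (s≤s z≤n)
    }
    where
    root∈S₀ : S₀ fzero ≡ true
    root∈S₀ = update-same ∅ fzero true
    only-root : ∀ w → S₀ w ≡ true → w ≡ fzero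
    only-root w w∈S₀ with fzero Fin.≟ w
    ... | yes 0≡w = sym 0≡w

  initial : Stage
  initial = record
    { tree      = root-only
    ; B         = ∅
    ; jumps     = 0
    ; B⊆S       = λ _ ()
    ; B-closed  = λ _ _ ()
    ; jumps≤|B| = z≤n
    ; |B|<|S|   = subst₂ _<_ (sym |∅|≡0) (sym |S₀|≡1) (s≤s z≤n)
    ; few-bad   = ≤-reflexive (trans (∑-insert ∅ {fzero} refl (λ w → bad fzero w))
                                     (cong₂ _+_ (coloured-loop c (not b) fzero) (sum-replicate-zero N)))
    ; few-good  = subst (λ s → inside c b S₀ ≤ (s ∸ 0) C 2) (sym |S₀|≡1)
                        (≤-reflexive (trans (inside-insert c b ∅ {fzero} refl) (cong₂ _+_ inside-∅ (sum-replicate-zero N))))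
    }
    where
    inside-∅ : inside c b ∅ ≡ 0
    inside-∅ = ∑-zero {N} λ i → ∑-zero {N} λ j → when-0 (i <ᵇ j)
      where
      when-0 : ∀ a → when a 0 ≡ 0
      when-0 true  = refl
      when-0 false = refl

  cheap-edge? : (T : PartialTree) →
                Dec (∃ λ y → S T y ≡ false × ∃ λ x → S T x ≡ true × bad x y ≡ 0)
  cheap-edge? T = Fin.any? λ y → (S T y ≟ᶜ false) ×-dec Fin.any? λ x → (S T x ≟ᶜ true) ×-dec (bad x y ≟ 0)

  extend : (st : Stage) → ∀ {v} → S (tree st) v ≡ false →
           Σ Stage λ st′ → size (S (tree st′)) ≡ suc (size (S (tree st)))
  extend st {v} v∉S with cheap-edge? (tree st)
  ... | yes (y , y∉S , x , x∈S , bad≡0) = attach st x∈S y∉S bad≡0 , grow-size (tree st) x∈S y∉S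
  ... | no no-cheap-edge = jump st v∉S forced , grow-size (tree st) (root∈S (tree st)) v∉S
    where
    forced : ∀ x y → S (tree st) x ≡ true → S (tree st) y ≡ false → good x y ≡ 0
    forced x y x∈S y∉S with good x y | coloured-complement c b (∉∈⇒≢ (S (tree st)) y∉S x∈S ∘ sym)
    ... | zero  | _        = refl
    ... | suc g | 1+g+bad≡1 = ⊥-elim (no-cheap-edge (y , y∉S , x , x∈S , m+n≡0⇒n≡0 g (suc-injective 1+g+bad≡1)))

  complete : ∀ m (st : Stage) → N ≤ size (S (tree st)) + m → Σ Stage λ st′ → ∀ w → S (tree st′) w ≡ true
  complete m st N≤|S|+m with Fin.any? (λ v → S (tree st) v ≟ᶜ false)
  ... | no none = st , λ w → ¬-not (λ w∉S → none (w , w∉S))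
  complete zero    st N≤|S|+0 | yes (v , v∉S) =
    ⊥-elim (<⇒≱ (size-missing (S (tree st)) v∉S) (subst (N ≤_) (+-identityʳ _) N≤|S|+0))
  complete (suc m) st N≤|S|+m | yes (v , v∉S) with extend st v∉S
  ... | st′ , grew = complete m st′ (subst (N ≤_) (trans (+-suc _ m) (cong (_+ m) (sym grew))) N≤|S|+m)

  greedy-tree : Σ (Fin N → ℕ) λ h → Σ (Fin N → Fin N) λ p → IsParentMap h p ×
                Σ ℕ λ k → treeCount c (not b) p ≤ k × eCol c b ≤ (N ∸ k) C 2
  greedy-tree with complete N initial (m≤n+m N (size (S (tree initial))))
  ... | st , spanning = height T , parent T , parentMap , jumps st , count-bad , count-good
    where
    T = tree st
    parentMap : IsParentMap (height T) (parent T)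
    parentMap = record { parent-root = parent-root T ; parent-lower = λ v → parent-lower T v (spanning v) }
    count-bad : treeCount c (not b) (parent T) ≤ jumps st
    count-bad = subst (_≤ jumps st) (sum-cong-≗ λ v → cong (λ a → when a (bad (parent T v) v)) (spanning v)) (few-bad st)
    count-good : eCol c b ≤ (N ∸ jumps st) C 2
    count-good = subst₂ (λ e s → e ≤ (s ∸ jumps st) C 2)
                        (trans (sumᴱ-cong λ i j → cong₂ (λ x y → when x (when y 𝟙[ c i j ≡ b ])) (spanning i) (spanning j))
                               (sym (eCol≡sumᴱ c b)))
                        (size-all (S T) spanning) (few-good st)

-- Balancing

∣⊖∣≤1 : ∀ {m n} → m ≤ n + 1 → n ≤ m + 1 → ∣ m ⊖ n ∣ ≤ 1
∣⊖∣≤1 {m} {n} m≤n+1 n≤m+1 with m ≤? n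
... | yes m≤n = subst (_≤ 1) (sym (ℤ.∣⊖∣-≤ m≤n)) (m≤n+o⇒m∸n≤o n m n≤m+1)
... | no m≰n  = subst (_≤ 1) (sym (trans (ℤ.∣m⊖n∣≡∣n⊖m∣ m n) (ℤ.∣⊖∣-≤ (<⇒≤ (≰⇒> m≰n))))) (m≤n+o⇒m∸n≤o m n m≤n+1)

balanced-⊖ : ∀ {P Q N} → P + Q + 1 ≡ N → P + P ≤ N → N ≤ P + P + 2 → ∣ P ⊖ Q ∣ ≤ 1
balanced-⊖ {P} {Q} {N} total 2P≤N N≤2P+2 = ∣⊖∣≤1 P≤Q+1 Q≤P+1
  where
  N≡P+[Q+1] : N ≡ P + (Q + 1)
  N≡P+[Q+1] = trans (sym total) (+-assoc P Q 1)
  P≤Q+1 : P ≤ Q + 1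
  P≤Q+1 = +-cancelˡ-≤ P P (Q + 1) (subst (P + P ≤_) N≡P+[Q+1] 2P≤N)
  Q≤P+1 : Q ≤ P + 1
  Q≤P+1 = +-cancelʳ-≤ 1 Q (P + 1) (+-cancelˡ-≤ P (Q + 1) (P + 1 + 1)
            (subst₂ _≤_ N≡P+[Q+1] (trans (+-assoc P P 2) (cong (P +_) (sym (+-assoc P 1 1)))) N≤2P+2))

complement-large : ∀ {P Q N} → P + Q + 1 ≡ N → Q + Q ≤ N → N ≤ P + P + 2
complement-large {P} {Q} {N} total 2Q≤N = +-cancelʳ-≤ N N (P + P + 2) (begin
  N + N                             ≡⟨ cong₂ _+_ total total ⟨
  (P + Q + 1) + (P + Q + 1)         ≡⟨ regroup P Q ⟩
  (P + P + 2) + (Q + Q)             ≤⟨ +-monoʳ-≤ (P + P + 2) 2Q≤N ⟩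
  (P + P + 2) + N                   ∎)
  where
  open ≤-Reasoning
  regroup : ∀ P Q → (P + Q + 1) + (P + Q + 1) ≡ (P + P + 2) + (Q + Q)
  regroup = solve-∀

discrete-ivt : ∀ K s (a : ℕ → ℕ) → (∀ k → a (suc k) ≤ a k + 1) → a 0 + a 0 ≤ s → s ≤ a K + a K + 2 →
               Σ ℕ λ k → a k + a k ≤ s × s ≤ a k + a k + 2
discrete-ivt zero    s a steps start end = 0 , start , end
discrete-ivt (suc K) s a steps start end with s ≤? a 0 + a 0 + 2
... | yes s≤2a₀+2 = 0 , start , s≤2a₀+2
... | no s≰2a₀+2 with discrete-ivt K s (λ k → a (suc k)) (λ k → steps (suc k)) 2a₁≤s end
  where
  2a₁≤s : a 1 + a 1 ≤ s
  2a₁≤s = ≤-trans (+-mono-≤ (steps 0) (steps 0))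
                  (≤-trans (≤-reflexive (regroup (a 0))) (<⇒≤ (≰⇒> s≰2a₀+2)))
    where
    regroup : ∀ x → (x + 1) + (x + 1) ≡ x + x + 2
    regroup = solve-∀
... | k , lower , upper = suc k , lower , upper

C-2-mono : ∀ {a b} → a ≤ b → a C 2 ≤ b C 2
C-2-mono z≤n = z≤n
C-2-mono {suc a} {suc b} (s≤s a≤b) = subst₂ _≤_ (sym (suc-C-2 a)) (sym (suc-C-2 b)) (+-mono-≤ a≤b (C-2-mono a≤b))

jumps-bound : ∀ N k e → e ≤ (N ∸ k) C 2 → ((N ∸ 1) / 2) C 2 < e → k + k ≤ N
jumps-bound N k e e≤ <e with k + k ≤? N
... | yes 2k≤N = 2k≤N
... | no 2k≰N  = ⊥-elim (<-irrefl refl (<-≤-trans <e (≤-trans e≤ (C-2-mono (half (N ∸ k) (N ∸ 1) twice≤)))))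
  where
  half : ∀ d y → d + d ≤ y → d ≤ y / 2
  half d y 2d≤y = subst (_≤ y / 2) (m*n/n≡m d 2)
                        (/-monoˡ-≤ 2 (subst (_≤ y) (trans (cong (d +_) (sym (+-identityʳ d))) (*-comm 2 d)) 2d≤y))
  twice≤ : (N ∸ k) + (N ∸ k) ≤ N ∸ 1
  twice≤ with k ≤? N
  ... | no k≰N = subst (λ d → d + d ≤ N ∸ 1) (sym (m≤n⇒m∸n≡0 (<⇒≤ (≰⇒> k≰N)))) z≤n
  ... | yes k≤N = <⇒≤pred (begin-strict
    (N ∸ k) + (N ∸ k) <⟨ +-monoʳ-< (N ∸ k) d<k ⟩
    (N ∸ k) + k       ≡⟨ m∸n+n≡m k≤N ⟩
    N                 ∎)
    where
    open ≤-Reasoning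
    d<k : N ∸ k < k
    d<k = +-cancelʳ-< k (N ∸ k) k (subst (_< k + k) (sym (m∸n+n≡m k≤N)) (≰⇒> 2k≰N))

1<∣⊖∣ : ∀ {m n} → 2 + n ≤ m → 1 < ∣ m ⊖ n ∣
1<∣⊖∣ {m} {n} 2+n≤m = subst (1 <_) (sym (trans (ℤ.∣m⊖n∣≡∣n⊖m∣ m n) (ℤ.∣⊖∣-≤ (m+n≤o⇒n≤o 2 2+n≤m))))
                             (m+n≤o⇒m≤o∸n 2 2+n≤m)

C-2≤square : ∀ m → m C 2 ≤ m * m
C-2≤square zero    = z≤n
C-2≤square (suc m) = begin
  suc m C 2             ≡⟨ suc-C-2 m ⟩
  m + m C 2             ≤⟨ +-monoʳ-≤ m (C-2≤square m) ⟩
  m + m * m             ≤⟨ m≤n+m (m + m * m) (suc m) ⟩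
  suc m + (m + m * m)   ≡⟨ expand m ⟩
  suc m * suc m         ∎
  where
  open ≤-Reasoning
  expand : ∀ m → suc m + (m + m * m) ≡ suc m * suc m
  expand = solve-∀

at-most-one-index : ∀ n k → ∑[ v < n ] when (toℕ v ℕ.≡ᵇ k) 1 ≤ 1
at-most-one-index zero    k       = z≤n
at-most-one-index (suc n) zero    = ≤-reflexive (cong suc (∑-zero {n} λ v → refl))
at-most-one-index (suc n) (suc k) = at-most-one-index n k

<ᵇ-suc : ∀ x k → (x ℕ.≡ᵇ k) ≡ false → (x ℕ.<ᵇ suc k) ≡ (x ℕ.<ᵇ k)
<ᵇ-suc zero    zero    ()
<ᵇ-suc zero    (suc k) _   = refl
<ᵇ-suc (suc x) zero    _   = refl
<ᵇ-suc (suc x) (suc k) x≢k = <ᵇ-suc x k x≢k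

module Interpolation {n} (c : Colouring (suc n)) where
  private
    N = suc n
    pos neg : (Fin N → Fin N) → ℕ
    pos = treeCount c true
    neg = treeCount c false

  mix : (p q : Fin N → Fin N) → ℕ → Fin N → Fin N
  mix p q k v = if toℕ v ℕ.<ᵇ k then q v else p v

  mix-parentMap : ∀ {h p q} → IsParentMap h p → IsParentMap h q → ∀ k → IsParentMap h (mix p q k)
  mix-parentMap {h} {p} {q} P Q k = record { parent-root = root ; parent-lower = lower }
    where
    root : mix p q k fzero ≡ fzero
    root with 0 ℕ.<ᵇ k
    ... | true  = IsParentMap.parent-root Q
    ... | false = IsParentMap.parent-root P
    lower : ∀ v → v ≢ fzero → h (mix p q k v) < h v
    lower v v≢0 with toℕ v ℕ.<ᵇ k
    ... | true  = IsParentMap.parent-lower Q v v≢0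
    ... | false = IsParentMap.parent-lower P v v≢0

  pos-mix-suc : ∀ p q k → pos (mix p q (suc k)) ≤ pos (mix p q k) + 1
  pos-mix-suc p q k = begin
    pos (mix p q (suc k))                                                ≤⟨ ∑-mono-≤ changed-only-at-k ⟩
    ∑[ v < N ] (coloured c true (mix p q k v) v + when (toℕ v ℕ.≡ᵇ k) 1) ≡⟨ ∑-distrib-+ (λ v → coloured c true (mix p q k v) v) (λ v → when (toℕ v ℕ.≡ᵇ k) 1) ⟩
    pos (mix p q k) + ∑[ v < N ] when (toℕ v ℕ.≡ᵇ k) 1                   ≤⟨ +-monoʳ-≤ (pos (mix p q k)) (at-most-one-index N k) ⟩
    pos (mix p q k) + 1                                                  ∎
    where
    open ≤-Reasoning
    changed-only-at-k : ∀ v → coloured c true (mix p q (suc k) v) v ≤ coloured c true (mix p q k v) v + when (toℕ v ℕ.≡ᵇ k) 1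
    changed-only-at-k v with toℕ v ℕ.≡ᵇ k in v≢k
    ... | true  = ≤-trans (coloured-≤1 c true _ v) (m≤n+m 1 _)
    ... | false = ≤-reflexive (trans (cong (λ b → coloured c true (if b then q v else p v) v) (<ᵇ-suc (toℕ v) k v≢k))
                                     (sym (+-identityʳ _)))

  pos-mix-end : ∀ p q → pos (mix p q N) ≡ pos q
  pos-mix-end p q = sum-cong-≗ λ v →
    cong (λ b → coloured c true (if b then q v else p v) v) (Equivalence.to T-≡ (<⇒<ᵇ (Fin.toℕ<n v)))

  Balanced : (Fin N → Fin N) → Set
  Balanced r = pos r + pos r ≤ N × N ≤ pos r + pos r + 2

  balanced-between : ∀ {h p q} → IsParentMap h p → IsParentMap h q → pos p + pos p ≤ N → N ≤ pos q + pos q + 2 →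
                     Σ (Fin N → Fin N) λ r → IsParentMap h r × Balanced r
  balanced-between {h} {p} {q} P Q low high with discrete-ivt N N (λ k → pos (mix p q k)) (pos-mix-suc p q) low
                                                               (subst (λ x → N ≤ x + x + 2) (sym (pos-mix-end p q)) high)
  ... | k , balanced = mix p q k , mix-parentMap P Q k , balanced

  balanced-spanningTree : ∀ {h r} → IsParentMap h r → Balanced r →
                          Σ (EdgeSet N) λ T → SpanningTree T × ∣ weight c T ∣ ≤ 1
  balanced-spanningTree {r = r} R (low , high) =
    treeEdges r , ParentMap.spanningTree R ,
    subst (λ w → ∣ w ∣ ≤ 1) (sym weight-treeEdges) (balanced-⊖ {pos r} {neg r} treeCount-total low high)
    where open TreeCount R c

  star : Fin N → Fin N
  star _ = fzero

  star-parentMap : ∀ {h p} → IsParentMap h p → IsParentMap h star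
  star-parentMap P = record { parent-root = refl ; parent-lower = ParentMap.height-root-least P }

  -- The two greedy trees lie on opposite sides of balance but come with different height functions;
  -- the star is a parent map for either height function, so we interpolate between it and one of them.
  balanced-tree : ((N ∸ 1) / 2) C 2 < eCol c false ⊓ eCol c true →
                  Σ (EdgeSet N) λ T → SpanningTree T × ∣ weight c T ∣ ≤ 1
  balanced-tree many with Greedy.greedy-tree c false | Greedy.greedy-tree c true | N ≤? pos star + pos star + 2
  ... | _ , pF , PF , kF , posF≤kF , eF | _ | yes star-high
    with balanced-between PF (star-parentMap PF) (≤-trans (+-mono-≤ posF≤kF posF≤kF) 2kF≤N) star-high
    where 2kF≤N = jumps-bound N kF _ eF (<-≤-trans many (m⊓n≤m _ _))
  ...   | _ , R , balanced = balanced-spanningTree R balanced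
  balanced-tree many | _ | _ , pT , PT , kT , negT≤kT , eT | no star-low
    with balanced-between (star-parentMap PT) PT (≤-trans (m≤m+n _ 2) (<⇒≤ (≰⇒> star-low)))
                          (complement-large {pos pT} {neg pT} (TreeCount.treeCount-total PT c) (≤-trans (+-mono-≤ negT≤kT negT≤kT) 2kT≤N))
    where 2kT≤N = jumps-bound N kT _ eT (<-≤-trans many (m⊓n≤n _ _))
  ...   | _ , R , balanced = balanced-spanningTree R balanced

-- Breadth-first trees

least-witness : {P : ℕ → Set} → (∀ k → Dec (P k)) → ∀ L → P L → Σ ℕ λ k → P k × (∀ j → j < k → ¬ P j)
least-witness P? zero    pL = 0 , pL , λ _ ()
least-witness P? (suc L) pL with P? 0
... | yes p0 = 0 , p0 , λ _ ()
... | no ¬p0 with least-witness (P? ∘ suc) L pL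
...   | k , pk , below = suc k , pk , λ { zero _ → ¬p0 ; (suc j) (s≤s j<k) → below j j<k }

module BreadthFirst {n} (t : EdgeSet (suc n)) (connected : Connected t) where
  private
    N = suc n

  Within : ℕ → Fin N → Set
  Within zero    u = u ≡ fzero
  Within (suc k) u = Within k u ⊎ ∃ λ x → Adj t u x × Within k x

  within? : ∀ k u → Dec (Within k u)
  within? zero    u = u Fin.≟ fzero
  within? (suc k) u = within? k u ⊎-dec Fin.any? (λ x → adj? {t = t} u x ×-dec within? k x)

  walk⇒within : ∀ {u} (r : Reach t u fzero) → Within (walk-length r) u
  walk⇒within here       = refl
  walk⇒within (step a r) = inj₂ (_ , a , walk⇒within r)

  private
    distance-spec : ∀ u → Σ ℕ λ k → Within k u × (∀ j → j < k → ¬ Within j u)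
    distance-spec u = least-witness (λ k → within? k u) _ (walk⇒within (connected u fzero))

  d : Fin N → ℕ
  d u = proj₁ (distance-spec u)

  within-d : ∀ u → Within (d u) u
  within-d u = proj₁ (proj₂ (distance-spec u))

  d-minimal : ∀ u j → Within j u → d u ≤ j
  d-minimal u j w = ≮⇒≥ λ j<d → proj₂ (proj₂ (distance-spec u)) j j<d w

  d≡0⇒root : ∀ {u} → d u ≡ 0 → u ≡ fzero
  d≡0⇒root {u} d≡0 = subst (λ k → Within k u) d≡0 (within-d u)

  d-root : d fzero ≡ 0
  d-root = n≤0⇒n≡0 (d-minimal fzero 0 refl)

  towards-root : ∀ u → u ≢ fzero → Σ (Fin N) λ x → Adj t u x × suc (d x) ≡ d u
  towards-root u u≢0 = go (d u) refl
    where
    go : ∀ D → d u ≡ D → Σ (Fin N) λ x → Adj t u x × suc (d x) ≡ d u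
    go zero    d≡0   = ⊥-elim (u≢0 (d≡0⇒root d≡0))
    go (suc k) d≡1+k with subst (λ D → Within D u) d≡1+k (within-d u)
    ... | inj₁ w = ⊥-elim (<⇒≱ (≤-reflexive (sym d≡1+k)) (d-minimal u k w))
    ... | inj₂ (x , a , w) = x , a , ≤-antisym (subst (suc (d x) ≤_) (sym d≡1+k) (s≤s (d-minimal x k w)))
                                               (d-minimal u (suc (d x)) (inj₂ (x , a , within-d x)))

  parent : Fin N → Fin N
  parent v with v Fin.≟ fzero
  ... | yes _   = fzero
  ... | no v≢0 = proj₁ (towards-root v v≢0)

  parent-spec : ∀ v → v ≢ fzero → Adj t v (parent v) × suc (d (parent v)) ≡ d v
  parent-spec v v≢0 with v Fin.≟ fzero
  ... | yes v≡0  = ⊥-elim (v≢0 v≡0)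
  ... | no  v≢0′ = proj₂ (towards-root v v≢0′)

  d-parent : ∀ v → d (parent v) ≡ pred (d v)
  d-parent v with v Fin.≟ fzero
  ... | yes refl = trans d-root (cong pred (sym d-root))
  ... | no  v≢0  = cong pred (proj₂ (proj₂ (towards-root v v≢0)))

  edge-to-parent : ∀ {v} → v ≢ fzero → Adj t v (parent v)
  edge-to-parent {v} v≢0 = proj₁ (parent-spec v v≢0)

  lower-nonroot : ∀ {i j} → i <ᶠ j → parent i ≡ j → i ≢ fzero
  lower-nonroot i<j p0≡j refl = <-irrefl (cong toℕ p0≡j) i<j

  upper-nonroot : ∀ {i j : Fin N} → i <ᶠ j → j ≢ fzero
  upper-nonroot i<j refl with () ← i<j

  parentMap : IsParentMap d parent
  parentMap = record
    { parent-root  = refl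
    ; parent-lower = λ v v≢0 → ≤-reflexive (proj₂ (parent-spec v v≢0))
    }

  ancestor : Fin N → ℕ → Fin N
  ancestor u zero    = u
  ancestor u (suc i) = parent (ancestor u i)

  d-ancestor : ∀ u i → d (ancestor u i) ≡ d u ∸ i
  d-ancestor u zero    = refl
  d-ancestor u (suc i) = trans (d-parent (ancestor u i)) (trans (cong pred (d-ancestor u i)) (pred[m∸n]≡m∸[1+n] (d u) i))

  ancestor-injective : ∀ u {i j} → i ≤ d u → j ≤ d u → ancestor u i ≡ ancestor u j → i ≡ j
  ancestor-injective u {i} {j} i≤d j≤d eq =
    ∸-cancelˡ-≡ i≤d j≤d (trans (sym (d-ancestor u i)) (trans (cong d eq) (d-ancestor u j)))

  ancestor-root : ∀ u → ancestor u (d u) ≡ fzero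
  ancestor-root u = d≡0⇒root (trans (d-ancestor u (d u)) (n∸n≡0 (d u)))

  ancestor-adj : ∀ u i → i < d u → Adj t (ancestor u i) (ancestor u (suc i))
  ancestor-adj u i i<d = edge-to-parent not-root
    where
    not-root : ancestor u i ≢ fzero
    not-root eq = <-irrefl (sym (trans (sym (d-ancestor u i)) (trans (cong d eq) d-root))) (m<n⇒0<n∸m i<d)

  module FirstMeeting (u w : Fin N) where

    MeetsAt : ℕ → Set
    MeetsAt i = Σ (Fin (suc (d w))) λ j → ancestor u i ≡ ancestor w (toℕ j)

    private
      meets-at-root : MeetsAt (d u)
      meets-at-root = fromℕ (d w) , trans (ancestor-root u)
                                          (sym (trans (cong (ancestor w) (Fin.toℕ-fromℕ (d w))) (ancestor-root w)))
      meeting = least-witness (λ i → Fin.any? λ j → ancestor u i Fin.≟ ancestor w (toℕ j)) (d u) meets-at-root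

    i* j* : ℕ
    i* = proj₁ meeting
    j* = toℕ (proj₁ (proj₁ (proj₂ meeting)))

    meets : ancestor u i* ≡ ancestor w j*
    meets = proj₂ (proj₁ (proj₂ meeting))

    none-earlier : ∀ i → i < i* → ¬ MeetsAt i
    none-earlier = proj₂ (proj₂ meeting)

    i*≤du : i* ≤ d u
    i*≤du = ≮⇒≥ λ du<i* → none-earlier (d u) du<i* meets-at-root

    j*≤dw : j* ≤ d w
    j*≤dw = s≤s⁻¹ (Fin.toℕ<n (proj₁ (proj₁ (proj₂ meeting))))

    first : ∀ {i j} → i ≤ i* → j ≤ j* → ancestor u i ≡ ancestor w j → i ≡ i*
    first {i} {j} i≤i* j≤j* eq with i <? i*
    ... | yes i<i* = ⊥-elim (none-earlier i i<i* (fromℕ< j<1+dw ,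
                                                  trans eq (cong (ancestor w) (sym (Fin.toℕ-fromℕ< j<1+dw)))))
      where j<1+dw = s≤s (≤-trans j≤j* j*≤dw)
    ... | no  i≮i* = ≤-antisym i≤i* (≮⇒≥ i≮i*)

  -- If neither endpoint is the parent of the other, their parent chains up to the first meeting close a cycle with uw.
  tree-edge⇒parent-edge : Acyclic t → ∀ {u w} → Adj t u w → parent u ≡ w ⊎ parent w ≡ u
  tree-edge⇒parent-edge acyclic {u} {w} uw with parent u Fin.≟ w | parent w Fin.≟ u
  ... | yes pu≡w | _        = inj₁ pu≡w
  ... | no _     | yes pw≡u = inj₂ pw≡u
  ... | no pu≢w  | no pw≢u  = ⊥-elim (acyclic (PathsToCycle.cycle (ancestor u) (ancestor w) i* j*
          (λ i i<i* → ancestor-adj u i (<-≤-trans i<i* i*≤du))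
          (λ j j<j* → ancestor-adj w j (<-≤-trans j<j* j*≤dw))
          (λ i≤i* i′≤i* → ancestor-injective u (≤-trans i≤i* i*≤du) (≤-trans i′≤i* i*≤du))
          (λ j≤j* j′≤j* → ancestor-injective w (≤-trans j≤j* j*≤dw) (≤-trans j′≤j* j*≤dw))
          first meets (adj-sym {t = t} uw) (at-least-two i* j* meets)))
    where
    open FirstMeeting u w
    at-least-two : ∀ i j → ancestor u i ≡ ancestor w j → 2 ≤ i + j
    at-least-two 0             0             u≡w  = ⊥-elim (adj-irrefl {t = t} uw u≡w)
    at-least-two 0             1             u≡pw = ⊥-elim (pw≢u (sym u≡pw))
    at-least-two 1             0             pu≡w = ⊥-elim (pu≢w pu≡w)
    at-least-two 0             (suc (suc j)) _    = s≤s (s≤s z≤n)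
    at-least-two 1             (suc j)       _    = s≤s (s≤s z≤n)
    at-least-two (suc (suc i)) j             _    = s≤s (s≤s z≤n)

  spanning-tree-edges : Acyclic t → ∀ i j → i <ᶠ j → t i j ≡ treeEdges parent i j
  spanning-tree-edges acyclic i j i<j with t i j in tij | treeEdges parent i j in pij
  ... | true  | true  = refl
  ... | false | false = refl
  ... | true  | false
    with () ← trans (sym (parent-edge∈treeEdges parent (tree-edge⇒parent-edge acyclic (inj₁ (i<j , tij))))) pij
  ... | false | true with ParentMap.adj-treeEdges parentMap (inj₁ (i<j , pij))
  ...   | inj₁ pi≡j
    with () ← trans (sym (adj-ordered {t = t} i<j (subst (Adj t i) pi≡j (edge-to-parent (lower-nonroot i<j pi≡j))))) tij
  ...   | inj₂ pj≡i
    with () ← trans (sym (adj-ordered {t = t} i<j (adj-sym {t = t} (subst (Adj t j) pj≡i (edge-to-parent (upper-nonroot i<j)))))) tij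

-- The extremal colouring

weight-cong : ∀ {n} (c : Colouring n) {t t′ : EdgeSet n} → (∀ i j → i <ᶠ j → t i j ≡ t′ i j) → weight c t ≡ weight c t′
weight-cong {n} c {t} {t′} t≡t′ = trans (weight≡count⊖count c t)
  (trans (cong₂ _⊖_ (count-cong true) (count-cong false)) (sym (weight≡count⊖count c t′)))
  where
  count-cong : ∀ b → count c t b ≡ count c t′ b
  count-cong b = sum-cong-≗ λ i → sum-cong-≗ λ j → same i j
    where
    same : ∀ i j → when (i <ᵇ j) (when (t i j) 𝟙[ c i j ≡ b ]) ≡ when (i <ᵇ j) (when (t′ i j) 𝟙[ c i j ≡ b ])
    same i j with i <ᵇ j in i<j
    ... | true  = cong (λ x → when x 𝟙[ c i j ≡ b ]) (t≡t′ i j (from-does (i Fin.<? j) i<j))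
    ... | false = refl

sumBelow : ℕ → (ℕ → ℕ) → ℕ
sumBelow zero    g = 0
sumBelow (suc k) g = sumBelow k g + g k

sumBelow-suc : ∀ k g → sumBelow (suc k) g ≡ g 0 + sumBelow k (λ x → g (suc x))
sumBelow-suc zero    g = +-comm 0 (g 0)
sumBelow-suc (suc k) g = trans (cong (_+ g (suc k)) (sumBelow-suc k g)) (+-assoc (g 0) _ _)

∑-toℕ : ∀ n g → ∑[ j < n ] g (toℕ j) ≡ sumBelow n g
∑-toℕ zero    g = refl
∑-toℕ (suc n) g = trans (cong (g 0 +_) (∑-toℕ n (λ x → g (suc x)))) (sym (sumBelow-suc n g))

∑-below : ∀ {n} (j : Fin n) x → ∑[ i < n ] when (i <ᵇ j) x ≡ toℕ j * x
∑-below {suc n} fzero    x = ∑-zero {n} λ i → refl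
∑-below {suc n} (fsuc j) x = cong (x +_) (∑-below j x)

∑-count-below : ∀ n a → ∑[ v < n ] when (toℕ v ℕ.<ᵇ a) 1 ≤ a
∑-count-below zero    a       = z≤n
∑-count-below (suc n) zero    = ≤-reflexive (∑-zero {n} λ v → refl)
∑-count-below (suc n) (suc a) = s≤s (∑-count-below n a)

𝟙[≤ᵇ≡false] : ∀ m x → 𝟙[ (m ℕ.≤ᵇ x) ≡ false ] ≡ when (x ℕ.<ᵇ m) 1
𝟙[≤ᵇ≡false] zero          x       = refl
𝟙[≤ᵇ≡false] (suc m)       zero    = refl
𝟙[≤ᵇ≡false] (suc zero)    (suc x) = refl
𝟙[≤ᵇ≡false] (suc (suc m)) (suc x) = 𝟙[≤ᵇ≡false] (suc m) x

≤ᵇ-true : ∀ {m x} → m ≤ x → (m ℕ.≤ᵇ x) ≡ true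
≤ᵇ-true m≤x = Equivalence.to T-≡ (≤⇒≤ᵇ m≤x)

<ᵇ-true : ∀ {x m} → x < m → (x ℕ.<ᵇ m) ≡ true
<ᵇ-true x<m = Equivalence.to T-≡ (<⇒<ᵇ x<m)

when-<ᵇ-antitone : ∀ {x y} a → x < y → when (y ℕ.<ᵇ a) 1 ≤ when (x ℕ.<ᵇ a) 1
when-<ᵇ-antitone {x} {y} a x<y with y ℕ.<ᵇ a in y<a
... | true rewrite <ᵇ-true (<-trans x<y (<ᵇ⇒< y a (Equivalence.from T-≡ y<a))) = ≤-refl
... | false = z≤n

-- The colour is −1 exactly on the edges inside the first m vertices.
module Extremal (n : ℕ) (3≤N : 3 ≤ suc n) where
  private
    N = suc n

  m : ℕ
  m = (N ∸ 1) / 2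

  colouring : Colouring N
  colouring i j = m ℕ.≤ᵇ toℕ j

  2m+1≤N : m + m + 1 ≤ N
  2m+1≤N = subst (m + m + 1 ≤_) (+-comm n 1) (+-monoˡ-≤ 1 (subst (_≤ n) (double m) (m/n*n≤m n 2)))
    where
    double : ∀ x → x * 2 ≡ x + x
    double = solve-∀

  1≤m : 1 ≤ m
  1≤m = m≥n⇒m/n>0 {n} {2} (s≤s⁻¹ 3≤N)
    where open import Data.Nat using (s≤s⁻¹)

  eCol-sumBelow : ∀ b → eCol colouring b ≡ sumBelow N (λ x → x * 𝟙[ (m ℕ.≤ᵇ x) ≡ b ])
  eCol-sumBelow b = begin
    eCol colouring b                                              ≡⟨ eCol≡sumᴱ colouring b ⟩
    sumᴱ N (λ i j → X (toℕ j))                                    ≡⟨ ∑-comm {N} {N} (λ i j → when (i <ᵇ j) (X (toℕ j))) ⟩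
    ∑[ j < N ] ∑[ i < N ] when (i <ᵇ j) (X (toℕ j))               ≡⟨ sum-cong-≗ {N} (λ j → ∑-below j (X (toℕ j))) ⟩
    ∑[ j < N ] (toℕ j * X (toℕ j))                                ≡⟨ ∑-toℕ N (λ x → x * X x) ⟩
    sumBelow N (λ x → x * X x)                                    ∎
    where
    open ≡-Reasoning
    X : ℕ → ℕ
    X x = 𝟙[ (m ℕ.≤ᵇ x) ≡ b ]

  private
    negative positive : ℕ → ℕ
    negative x = x * 𝟙[ (m ℕ.≤ᵇ x) ≡ false ]
    positive x = x * 𝟙[ (m ℕ.≤ᵇ x) ≡ true ]

  sumBelow-negative : ∀ k → k ≤ m → sumBelow k negative ≡ k C 2
  sumBelow-negative zero    _   = refl
  sumBelow-negative (suc k) k<m = begin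
    sumBelow k negative + negative k  ≡⟨ cong₂ _+_ (sumBelow-negative k (<⇒≤ k<m)) k-negative ⟩
    k C 2 + k                         ≡⟨ +-comm (k C 2) k ⟩
    k + k C 2                         ≡⟨ suc-C-2 k ⟨
    suc k C 2                         ∎
    where
    open ≡-Reasoning
    k-negative : negative k ≡ k
    k-negative = trans (cong (k *_) (trans (𝟙[≤ᵇ≡false] m k) (cong (λ b → when b 1) (<ᵇ-true k<m)))) (*-identityʳ k)

  sumBelow-negative-beyond : ∀ d → sumBelow (m + d) negative ≡ m C 2
  sumBelow-negative-beyond zero    = trans (cong (λ k → sumBelow k negative) (+-identityʳ m)) (sumBelow-negative m ≤-refl)
  sumBelow-negative-beyond (suc d) = begin
    sumBelow (m + suc d) negative                 ≡⟨ cong (λ k → sumBelow k negative) (+-suc m d) ⟩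
    sumBelow (m + d) negative + negative (m + d)  ≡⟨ cong (sumBelow (m + d) negative +_) m+d-positive ⟩
    sumBelow (m + d) negative + 0                 ≡⟨ +-identityʳ _ ⟩
    sumBelow (m + d) negative                     ≡⟨ sumBelow-negative-beyond d ⟩
    m C 2                                         ∎
    where
    open ≡-Reasoning
    m+d-positive : negative (m + d) ≡ 0
    m+d-positive = trans (cong (λ b → (m + d) * 𝟙[ b ≡ false ]) (≤ᵇ-true (m≤m+n m d))) (*-zeroʳ (m + d))

  sumBelow-positive-beyond : ∀ d → d * m ≤ sumBelow (m + d) positive
  sumBelow-positive-beyond zero    = z≤n
  sumBelow-positive-beyond (suc d) = begin
    m + d * m                                     ≡⟨ +-comm m (d * m) ⟩
    d * m + m                                     ≤⟨ +-mono-≤ (sumBelow-positive-beyond d) m≤positive ⟩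
    sumBelow (m + d) positive + positive (m + d)  ≡⟨ cong (λ k → sumBelow k positive) (+-suc m d) ⟨
    sumBelow (m + suc d) positive                 ∎
    where
    open ≤-Reasoning
    m≤positive : m ≤ positive (m + d)
    m≤positive rewrite ≤ᵇ-true (m≤m+n m d) | *-identityʳ (m + d) = m≤m+n m d

  m≤N∸m : m ≤ N ∸ m
  m≤N∸m = m+n≤o⇒m≤o∸n m (m+n≤o⇒m≤o (m + m) 2m+1≤N)

  eCol-negative : eCol colouring false ≡ m C 2
  eCol-negative = trans (eCol-sumBelow false)
    (trans (cong (λ k → sumBelow k negative) (sym (m+[n∸m]≡n (≤-trans m≤N∸m (m∸n≤m N m)))))
           (sumBelow-negative-beyond (N ∸ m)))

  eCol-positive : m C 2 ≤ eCol colouring true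
  eCol-positive = begin
    m C 2                                   ≤⟨ C-2≤square m ⟩
    m * m                                   ≤⟨ *-monoˡ-≤ m m≤N∸m ⟩
    (N ∸ m) * m                             ≤⟨ sumBelow-positive-beyond (N ∸ m) ⟩
    sumBelow (m + (N ∸ m)) positive         ≡⟨ cong (λ k → sumBelow k positive) (m+[n∸m]≡n (≤-trans m≤N∸m (m∸n≤m N m))) ⟩
    sumBelow N positive                     ≡⟨ eCol-sumBelow true ⟨
    eCol colouring true                     ∎
    where open ≤-Reasoning

  negative-edge-below : ∀ u v → coloured colouring false u v ≤ when (toℕ v ℕ.<ᵇ m) 1
  negative-edge-below u v with u <ᵇ v in u<v | v <ᵇ u in v<u
  ... | true  | true  = ⊥-elim (<-asym (from-does (u Fin.<? v) u<v) (from-does (v Fin.<? u) v<u))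
  ... | true  | false = ≤-reflexive (trans (+-identityʳ _) (𝟙[≤ᵇ≡false] m (toℕ v)))
  ... | false | true  = subst (_≤ when (toℕ v ℕ.<ᵇ m) 1) (sym (𝟙[≤ᵇ≡false] m (toℕ u)))
                              (when-<ᵇ-antitone m (from-does (v Fin.<? u) v<u))
  ... | false | false = z≤n

  unbalanced : ∀ T → SpanningTree T → 1 < ∣ weight colouring T ∣
  unbalanced T (connected , acyclic) = subst (λ w → 1 < ∣ w ∣) (sym weight≡pos⊖neg) (1<∣⊖∣ gap)
    where
    open BreadthFirst T connected
    open TreeCount parentMap colouring
    pos neg : ℕ
    pos = treeCount colouring true parent
    neg = treeCount colouring false parent
    weight≡pos⊖neg : weight colouring T ≡ pos ⊖ neg
    weight≡pos⊖neg = trans (weight-cong colouring (spanning-tree-edges acyclic)) weight-treeEdges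
    root : Fin N → ℕ
    root v = when (fzero ≡ᵇ v) 1
    inside-first-m : ∀ v → coloured colouring false (parent v) v + root v ≤ when (toℕ v ℕ.<ᵇ m) 1
    inside-first-m v with v Fin.≟ fzero
    ... | yes refl rewrite <ᵇ-true 1≤m = ≤-refl
    ... | no v≢0 rewrite dec-false (fzero Fin.≟ v) (λ 0≡v → v≢0 (sym 0≡v)) =
      ≤-trans (≤-reflexive (+-identityʳ _)) (negative-edge-below _ v)
    neg<m : neg + 1 ≤ m
    neg<m = begin
      neg + 1                                                  ≡⟨ cong (neg +_) (∑-when-≡ᵇ {N} fzero (λ _ → 1)) ⟨
      neg + ∑[ v < N ] root v                                  ≡⟨ ∑-distrib-+ (λ v → coloured colouring false (parent v) v) root ⟨
      ∑[ v < N ] (coloured colouring false (parent v) v + root v) ≤⟨ ∑-mono-≤ inside-first-m ⟩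
      ∑[ v < N ] when (toℕ v ℕ.<ᵇ m) 1                         ≤⟨ ∑-count-below N m ⟩
      m                                                        ∎
      where open ≤-Reasoning
    gap : 2 + neg ≤ pos
    gap = +-cancelʳ-≤ (neg + 1) (2 + neg) pos (begin
      (2 + neg) + (neg + 1)      ≡⟨ regroup neg ⟩
      (neg + 1) + (neg + 1) + 1  ≤⟨ +-monoˡ-≤ 1 (+-mono-≤ neg<m neg<m) ⟩
      m + m + 1                  ≤⟨ 2m+1≤N ⟩
      N                          ≡⟨ treeCount-total ⟨
      pos + neg + 1              ≡⟨ +-assoc pos neg 1 ⟩
      pos + (neg + 1)            ∎)
      where
      open ≤-Reasoning
      regroup : ∀ x → (2 + x) + (x + 1) ≡ (x + 1) + (x + 1) + 1
      regroup = solve-∀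

  extremal : Σ (Colouring N) λ f → (eCol f false ⊓ eCol f true ≡ m C 2) × (∀ T → SpanningTree T → 1 < ∣ weight f T ∣)
  extremal = colouring , trans (cong (_⊓ eCol colouring true) eCol-negative) (m≤n⇒m⊓n≡m eCol-positive) , unbalanced

theorem4p6 :
    ((n : ℕ) → 1 ≤ n → (f : Colouring n) →
       ((n ∸ 1) / 2) C 2 < eCol f false ⊓ eCol f true →
       Σ (EdgeSet n) (λ T → SpanningTree T × ∣ weight f T ∣ ≤ 1))
    ×
    ((n : ℕ) → 3 ≤ n →
       Σ (Colouring n) (λ f →
         (eCol f false ⊓ eCol f true ≡ ((n ∸ 1) / 2) C 2) ×
         ((T : EdgeSet n) → SpanningTree T → 1 < ∣ weight f T ∣)))
theorem4p6 = (λ { (suc n) _ → Interpolation.balanced-tree }) , λ { (suc n) 3≤n → Extremal.extremal n 3≤n }
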